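{- Let $M$ and $M'$ be matroids without loops and without coloops, let $P$ be a condensation of $\mathcal Z(M)$ with system of representatives $\{R_B\}_{B\in P}$, and let $P'$ be a condensation of $\mathcal Z(M')$ with system of representatives $\{R'_{B'}\}_{B'\in P'}$. Suppose there is a bijection $\varphi:P\to P'$ such that for all $B,C\in P$: $A_{P'}(\varphi(B),\varphi(C))=A_P(B,C)$, $|R'_{\varphi(B)}|=|R_B|$ and $r_{M'}(R'_{\varphi(B)})=r_M(R_B)$. Then $R_M(x,y)=R_{M'}(x,y)$, where $R_N(x,y)=\sum_{X\subseteq E(N)}x^{r_N(E(N))-r_N(X)}y^{|X|-r_N(X)}$ is the rank generating polynomial. That is, the rank generating polynomial (equivalently the Tutte polynomial $T_N(x,y)=R_N(x-1,y-1)$) is determined by a condensed configuration.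
   Context: A flat $X$ of a matroid $N$ is cyclic if $N|X$ has no coloops; $\mathcal Z(N)$ is the set of cyclic flats. A partition $P$ of $\mathcal Z(N)$ is a condensation if for all blocks $B,C\in P$: (1) cardinality and rank are constant on $B$; (2) the number $A_P(B,C):=|\{X\in B: X\subseteq Y\}|$ is independent of the choice of $Y\in C$. The condensed configuration corresponding to $P$ consists of the matrix $(A_P(B,C))_{B,C\in P}$ and the cardinality and rank of a representative $R_B$ of each block $B$. -}

module Defs where

open import Data.Nat using (ℕ; zero; suc; _+_; _∸_; _≤_; _<_; _<?_)
import Data.Nat.Properties as ℕP
open import Data.Fin using (Fin)
import Data.Fin.Properties as FinP
open import Data.Fin.Subset
  using (Subset; ⁅_⁆; _∈_; _∉_; _⊆_; _∩_; _∪_; _-_; ∣_∣; ⊤; ⊥; inside; outside)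
open import Data.Fin.Subset.Properties using (_∈?_; _⊆?_)
open import Data.List using (List; []; _∷_; _++_; map; filter; length)
open import Data.Vec using (_∷_; [])
open import Data.Product using (_×_; _,_; ∃)
open import Relation.Nullary using (¬_; Dec)
open import Relation.Nullary.Decidable using (_×-dec_; _→-dec_; ¬?)
open import Relation.Unary using (Pred; Decidable)
open import Level using (0ℓ)
open import Relation.Binary.PropositionalEquality using (_≡_)

allSubsets : (n : ℕ) → List (Subset n)
allSubsets zero    = [] ∷ []
allSubsets (suc n) = map (inside ∷_) (allSubsets n) ++ map (outside ∷_) (allSubsets n)

count : ∀ {n} {P : Pred (Subset n) 0ℓ} → Decidable P → ℕ
count {n} P? = length (filter P? (allSubsets n))

record Matroid (n : ℕ) : Set where
  field
    rank      : Subset n → ℕ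
    rank-card : ∀ X → rank X ≤ ∣ X ∣
    rank-mono : ∀ {X Y} → X ⊆ Y → rank X ≤ rank Y
    rank-sub  : ∀ X Y → rank (X ∪ Y) + rank (X ∩ Y) ≤ rank X + rank Y

open Matroid public

module _ {n : ℕ} (M : Matroid n) where

  Loopless : Set
  Loopless = ∀ (e : Fin n) → ¬ (rank M ⁅ e ⁆ ≡ 0)

  Coloopless : Set
  Coloopless = ∀ (e : Fin n) → rank M (⊤ - e) ≡ rank M ⊤

  IsFlat : Subset n → Set
  IsFlat X = ∀ (e : Fin n) → e ∉ X → rank M X < rank M (X ∪ ⁅ e ⁆)

  IsCyclic : Subset n → Set
  IsCyclic X = ∀ (e : Fin n) → e ∈ X → rank M (X - e) ≡ rank M X

  IsCyclicFlat : Subset n → Set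
  IsCyclicFlat X = IsFlat X × IsCyclic X

  isFlat? : Decidable IsFlat
  isFlat? X = FinP.all? λ e → ¬? (e ∈? X) →-dec (rank M X <? rank M (X ∪ ⁅ e ⁆))

  isCyclic? : Decidable IsCyclic
  isCyclic? X = FinP.all? λ e → (e ∈? X) →-dec (rank M (X - e) ℕP.≟ rank M X)

  isCyclicFlat? : Decidable IsCyclicFlat
  isCyclicFlat? X = isFlat? X ×-dec isCyclic? X

  -- Coefficient of x^a y^b in the rank generating polynomial
  --   R_M(x,y) = Σ_{X ⊆ E} x^{r(E) - r(X)} y^{|X| - r(X)}
  -- i.e. the number of X ⊆ E with r(E) - r(X) = a and |X| - r(X) = b.
  -- (A polynomial is identified with its family of coefficients.)
  rankGenCoeff : ℕ → ℕ → ℕ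
  rankGenCoeff a b =
    count {P = λ X → (rank M ⊤ ∸ rank M X ≡ a) × (∣ X ∣ ∸ rank M X ≡ b)}
          (λ X → (rank M ⊤ ∸ rank M X ℕP.≟ a) ×-dec (∣ X ∣ ∸ rank M X ℕP.≟ b))

-- A partition of Z(M) into k (nonempty) blocks, indexed by Fin k, is given by
-- a block-assignment function blk (only its values on cyclic flats matter).

module _ {n : ℕ} (M : Matroid n) {k : ℕ} (blk : Subset n → Fin k) where

  Acount : Fin k → Subset n → ℕ
  Acount i Y =
    count {P = λ X → IsCyclicFlat M X × (blk X ≡ i) × (X ⊆ Y)}
          (λ X → isCyclicFlat? M X ×-dec ((blk X FinP.≟ i) ×-dec (X ⊆? Y)))

record Condensation {n : ℕ} (M : Matroid n) (k : ℕ) : Set where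
  field
    blk       : Subset n → Fin k
    blk-nonempty : ∀ (i : Fin k) → ∃ λ X → IsCyclicFlat M X × (blk X ≡ i)
    blk-card  : ∀ X Y → IsCyclicFlat M X → IsCyclicFlat M Y → blk X ≡ blk Y →
                ∣ X ∣ ≡ ∣ Y ∣
    blk-rank  : ∀ X Y → IsCyclicFlat M X → IsCyclicFlat M Y → blk X ≡ blk Y →
                rank M X ≡ rank M Y
    blk-A     : ∀ (i : Fin k) Y Y' → IsCyclicFlat M Y → IsCyclicFlat M Y' →
                blk Y ≡ blk Y' → Acount M blk i Y ≡ Acount M blk i Y'

open Condensation public

IsRepSystem : ∀ {n k} {M : Matroid n} → Condensation M k → (Fin k → Subset n) → Set
IsRepSystem {M = M} P R = ∀ i → IsCyclicFlat M (R i) × (blk P (R i) ≡ i)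

-- A_P(B,C), computed via the representative of C (well defined by blk-A)
A : ∀ {n k} {M : Matroid n} → Condensation M k → (Fin k → Subset n) →
    Fin k → Fin k → ℕ
A {M = M} P R i j = Acount M (blk P) i (R j)

-- Let F be a cyclic set and G ⊇ F a flat.  Every Z ⊆ G ∖ F has a unique core: the cyclic flat
-- H = cl(F ∪ Z) minus its coloops.  It satisfies F ⊆ H ⊆ G, F ∪ (Z ∩ H) spans H, and Z ∖ H is free
-- over H (H ∪ (Z ∖ H) is a flat of rank r H + |Z ∖ H|), and every such triple arises from one Z.
-- Counting the s-subsets of G ∖ F by their core and summing F over a block B gives, for a cyclic
-- flat G,
--   A(B, G) · C(|G| − |R_B|, s) = Σ_C Σ_{H ∈ C, H ⊆ G} (σ_B(H) ⋆ free(H, G)) s,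
-- where σ_B(H) counts by size the sets spanning H over a member of B, free(H, G) counts the sets
-- free over H inside G, and ι_B(G) sums free(F, G) over the members F ⊆ G of B.  The summands for
-- C = B and C = block(G) are ι_B(G) s and σ_B(G) s, the others only involve pairs with a smaller
-- size difference, and for each s one of σ_B(G) s, ι_B(G) s vanishes by a rank count.  So, by
-- induction on |G| − |R_B|, all σ's and ι's are determined by the condensed configuration, and so
-- is the rank generating polynomial: splitting each X ⊆ E along its core (F = ∅, G = E) expresses
-- its coefficients through the σ_{block(∅)}(R_B) and ι_B(E).

module Submission where

open import Defs
open import Data.Nat using (ℕ; zero; suc; _+_; _*_; _∸_; _≤_; _<_; z≤n; s≤s; _≟_; _≤?_; _<?_)
open import Data.Nat.Properties
open import Data.Nat.Combinatorics using (nCk+nC[k+1]≡[n+1]C[k+1]) renaming (_C_ to _choose_)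
open import Algebra.Properties.Semiring.Sum +-*-semiring
  using (sum; sum-cong-≗; sum-replicate-zero; ∑-distrib-+; *-distribˡ-sum; *-distribʳ-sum; ∑-permute)
open import Algebra.Properties.CommutativeSemigroup +-commutativeSemigroup
  using () renaming (interchange to +-interchange)
open import Algebra.Properties.CommutativeSemigroup *-commutativeSemigroup
  using () renaming (x∙yz≈y∙xz to x*yz≡y*xz)
open import Data.Fin as Fin using (Fin; toℕ; fromℕ<)
import Data.Fin.Properties as Fin
open import Data.Fin.Subset
open import Data.Fin.Subset.Properties
open import Data.Fin.Subset.Induction using (⊂-wellFounded)
open import Data.Nat.Induction using (<-rec)
open import Induction.WellFounded using (module All)
open import Data.Vec using (_∷_; []; here; there)
open import Data.Vec.Properties using (∷-injectiveʳ)
open import Data.List using ([]; _∷_; length; filter; map; _++_)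
open import Data.List.Properties using (length-++; filter-++)
open import Data.Bool using (true; false)
open import Data.Product using (_×_; _,_; proj₁; proj₂)
open import Data.Sum using (_⊎_; inj₁; inj₂)
open import Data.Empty using (⊥-elim)
open import Function using (_∘_)
open import Function.Bundles using (_⤖_; Bijection)
open import Function.Properties.Bijection using (⤖⇒↔)
open import Function.Construct.Identity using (⤖-id)
open import Relation.Nullary using (Dec; yes; no; ¬_; does)
open import Relation.Nullary.Decidable using (_×-dec_; ¬?)
open import Relation.Unary using (Pred; Decidable)
open import Relation.Binary.PropositionalEquality
  using (_≡_; _≢_; refl; sym; trans; cong; cong₂; subst; subst₂; module ≡-Reasoning)
open import Level using (0ℓ)

private
  variable
    n : ℕ

x∈p─q⇒x∉q : ∀ {x : Fin n} (p q : Subset n) → x ∈ p ─ q → x ∉ q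
x∈p─q⇒x∉q (_ ∷ p) (outside ∷ q) here       ()
x∈p─q⇒x∉q (_ ∷ p) (_ ∷ q)       (there x∈) (there x∈q) = x∈p─q⇒x∉q p q x∈ x∈q

x∈p-y⇒x≢y : ∀ {x y : Fin n} (p : Subset n) → x ∈ p - y → x ≢ y
x∈p-y⇒x≢y {y = y} p x∈ refl = x∈p─q⇒x∉q p ⁅ y ⁆ x∈ (x∈⁅x⁆ y)

∪-least : ∀ {p q r : Subset n} → p ⊆ r → q ⊆ r → p ∪ q ⊆ r
∪-least {p = p} {q} p⊆r q⊆r x∈ with x∈p∪q⁻ p q x∈
... | inj₁ x∈p = p⊆r x∈p
... | inj₂ x∈q = q⊆r x∈q

∪-mono : ∀ {p q p′ q′ : Subset n} → p ⊆ p′ → q ⊆ q′ → p ∪ q ⊆ p′ ∪ q′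
∪-mono {p′ = p′} {q′} p⊆ q⊆ = ∪-least (p⊆p∪q q′ ∘ p⊆) (q⊆p∪q p′ q′ ∘ q⊆)

∈-∪-─ : ∀ {x : Fin n} (p q : Subset n) → x ∈ q → x ∈ p ∪ (q ─ p)
∈-∪-─ {x = x} p q x∈q with x ∈? p
... | yes x∈p = p⊆p∪q (q ─ p) x∈p
... | no  x∉p = q⊆p∪q p (q ─ p) (x∈p∧x∉q⇒x∈p─q x∈q x∉p)

∈-─-∪ : ∀ {x : Fin n} (p q : Subset n) → x ∈ q → x ∈ (q ─ p) ∪ p
∈-─-∪ p q x∈q = subst (_ ∈_) (∪-comm p (q ─ p)) (∈-∪-─ p q x∈q)

⁅x⁆⊆ : ∀ {x : Fin n} {p : Subset n} → x ∈ p → ⁅ x ⁆ ⊆ p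
⁅x⁆⊆ {p = p} x∈p y∈⁅x⁆ = subst (_∈ p) (sym (x∈⁅y⁆⇒x≡y _ y∈⁅x⁆)) x∈p

p-x∪⁅x⁆ : ∀ {x : Fin n} {p : Subset n} → x ∈ p → (p - x) ∪ ⁅ x ⁆ ≡ p
p-x∪⁅x⁆ {x = x} {p} x∈p =
  ⊆-antisym (∪-least (p─q⊆p p ⁅ x ⁆) (⁅x⁆⊆ x∈p))
            (∈-─-∪ ⁅ x ⁆ p)

disjoint : ∀ (p q : Subset n) → (∀ {x} → x ∈ p → x ∉ q) → p ∩ q ≡ ⊥
disjoint p q h = Empty-unique λ (x , x∈) → let x∈p , x∈q = x∈p∩q⁻ p q x∈ in h x∈p x∈q

∣p∪q∣+∣p∩q∣ : ∀ (p q : Subset n) → ∣ p ∪ q ∣ + ∣ p ∩ q ∣ ≡ ∣ p ∣ + ∣ q ∣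
∣p∪q∣+∣p∩q∣ []            []            = refl
∣p∪q∣+∣p∩q∣ (inside ∷ p)  (inside ∷ q)  =
  cong suc (trans (+-suc _ _) (trans (cong suc (∣p∪q∣+∣p∩q∣ p q)) (sym (+-suc _ _))))
∣p∪q∣+∣p∩q∣ (inside ∷ p)  (outside ∷ q) = cong suc (∣p∪q∣+∣p∩q∣ p q)
∣p∪q∣+∣p∩q∣ (outside ∷ p) (inside ∷ q)  = trans (cong suc (∣p∪q∣+∣p∩q∣ p q)) (sym (+-suc _ _))
∣p∪q∣+∣p∩q∣ (outside ∷ p) (outside ∷ q) = ∣p∪q∣+∣p∩q∣ p q

∣p∪q∣-disjoint : ∀ (p q : Subset n) → p ∩ q ≡ ⊥ → ∣ p ∪ q ∣ ≡ ∣ p ∣ + ∣ q ∣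
∣p∪q∣-disjoint {n} p q p∩q≡⊥ =
  begin
    ∣ p ∪ q ∣               ≡⟨ +-identityʳ ∣ p ∪ q ∣ ⟨
    ∣ p ∪ q ∣ + 0           ≡⟨ cong (∣ p ∪ q ∣ +_) ∣p∩q∣≡0 ⟨
    ∣ p ∪ q ∣ + ∣ p ∩ q ∣   ≡⟨ ∣p∪q∣+∣p∩q∣ p q ⟩
    ∣ p ∣ + ∣ q ∣           ∎
  where
  open ≡-Reasoning
  ∣p∩q∣≡0 : ∣ p ∩ q ∣ ≡ 0
  ∣p∩q∣≡0 = trans (cong ∣_∣ p∩q≡⊥) (∣⊥∣≡0 n)

suc∣p-x∣ : ∀ {x : Fin n} (p : Subset n) → x ∈ p → suc ∣ p - x ∣ ≡ ∣ p ∣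
suc∣p-x∣ {x = Fin.zero}  (inside ∷ p)  here       = cong (suc ∘ ∣_∣) (p─⊥≡p p)
suc∣p-x∣ {x = Fin.suc x} (inside ∷ p)  (there x∈) = cong suc (suc∣p-x∣ p x∈)
suc∣p-x∣ {x = Fin.suc x} (outside ∷ p) (there x∈) = suc∣p-x∣ p x∈

∣q─p∣+∣p∣ : ∀ {p q : Subset n} → p ⊆ q → ∣ q ─ p ∣ + ∣ p ∣ ≡ ∣ q ∣
∣q─p∣+∣p∣ {p = p} {q} p⊆q =
  trans (sym (∣p∪q∣-disjoint (q ─ p) p (disjoint (q ─ p) p (x∈p─q⇒x∉q q p))))
        (cong ∣_∣ (⊆-antisym (∪-least (p─q⊆p q p) p⊆q) (∈-─-∪ p q)))

⊆-∣∣-≡ : ∀ {p q : Subset n} → p ⊆ q → ∣ q ∣ ≤ ∣ p ∣ → p ≡ q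
⊆-∣∣-≡ {p = p} {q} p⊆q ∣q∣≤∣p∣ = ⊆-antisym p⊆q q⊆p
  where
  q⊆p : q ⊆ p
  q⊆p {x} x∈q with x ∈? p
  ... | yes x∈p = x∈p
  ... | no  x∉p = ⊥-elim (<⇒≱ (p⊂q⇒∣p∣<∣q∣ (p⊆q , x , x∈q , x∉p)) ∣q∣≤∣p∣)

─-disjoint : ∀ (F H G : Subset n) → (H ─ F) ∩ (G ─ H) ≡ ⊥
─-disjoint F H G =
  disjoint (H ─ F) (G ─ H) λ x∈H─F x∈G─H → x∈p─q⇒x∉q G H x∈G─H (p─q⊆p H F x∈H─F)

─-split : ∀ {F H G : Subset n} → F ⊆ H → H ⊆ G → G ─ F ≡ (H ─ F) ∪ (G ─ H)
─-split {F = F} {H} {G} F⊆H H⊆G = ⊆-antisym G─F⊆ (∪-least H─F⊆ G─H⊆)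
  where
  G─F⊆ : G ─ F ⊆ (H ─ F) ∪ (G ─ H)
  G─F⊆ {x} x∈ with x ∈? H
  ... | yes x∈H = p⊆p∪q (G ─ H) (x∈p∧x∉q⇒x∈p─q x∈H (x∈p─q⇒x∉q G F x∈))
  ... | no  x∉H = q⊆p∪q (H ─ F) (G ─ H) (x∈p∧x∉q⇒x∈p─q (p─q⊆p G F x∈) x∉H)
  H─F⊆ : H ─ F ⊆ G ─ F
  H─F⊆ x∈ = x∈p∧x∉q⇒x∈p─q (H⊆G (p─q⊆p H F x∈)) (x∈p─q⇒x∉q H F x∈)
  G─H⊆ : G ─ H ⊆ G ─ F
  G─H⊆ x∈ = x∈p∧x∉q⇒x∈p─q (p─q⊆p G H x∈) (x∈p─q⇒x∉q G H x∈ ∘ F⊆H)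

module _ {Y J H : Subset n} (Y⊆H : Y ⊆ H) (J∩H≡⊥ : ∀ {x} → x ∈ J → x ∉ H) where

  ∪-∩-cancel : (Y ∪ J) ∩ H ≡ Y
  ∪-∩-cancel = ⊆-antisym ⊆Y (λ x∈Y → x∈p∩q⁺ (p⊆p∪q J x∈Y , Y⊆H x∈Y))
    where
    ⊆Y : (Y ∪ J) ∩ H ⊆ Y
    ⊆Y x∈ with x∈p∩q⁻ (Y ∪ J) H x∈
    ... | x∈Y∪J , x∈H with x∈p∪q⁻ Y J x∈Y∪J
    ...   | inj₁ x∈Y = x∈Y
    ...   | inj₂ x∈J = ⊥-elim (J∩H≡⊥ x∈J x∈H)

  ∪-─-cancel : (Y ∪ J) ─ H ≡ J
  ∪-─-cancel = ⊆-antisym ⊆J (λ x∈J → x∈p∧x∉q⇒x∈p─q (q⊆p∪q Y J x∈J) (J∩H≡⊥ x∈J))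
    where
    ⊆J : (Y ∪ J) ─ H ⊆ J
    ⊆J {x} x∈ with x∈p∪q⁻ Y J (p─q⊆p (Y ∪ J) H x∈)
    ... | inj₁ x∈Y = ⊥-elim (x∈p─q⇒x∉q (Y ∪ J) H x∈ (Y⊆H x∈Y))
    ... | inj₂ x∈J = x∈J

p─p≡⊥ : ∀ (p : Subset n) → p ─ p ≡ ⊥
p─p≡⊥ p = Empty-unique λ (x , x∈) → x∈p─q⇒x∉q p p x∈ (p─q⊆p p p x∈)

remove-induction : (P : Subset n → Set) → P ⊥ → (∀ D d → d ∈ D → P (D - d) → P D) → ∀ D → P D
remove-induction P base step = All.wfRec ⊂-wellFounded 0ℓ P go
  where
  go : ∀ D → (∀ {D′} → D′ ⊂ D → P D′) → P D
  go D rec with nonempty? D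
  ... | yes (d , d∈D) = step D d d∈D (rec (x∈p⇒p-x⊂p d∈D))
  ... | no  D-empty   = subst P (sym (Empty-unique D-empty)) base

select : {P : Fin n → Set} → Decidable P → Subset n
select {zero}  P? = []
select {suc n} P? = does (P? Fin.zero) ∷ select (P? ∘ Fin.suc)

∈-select⁺ : ∀ {P : Fin n → Set} (P? : Decidable P) {x} → P x → x ∈ select P?
∈-select⁺ P? {Fin.zero} p with P? Fin.zero
... | yes _ = here
... | no ¬p = ⊥-elim (¬p p)
∈-select⁺ P? {Fin.suc x} p = there (∈-select⁺ (P? ∘ Fin.suc) p)

∈-select⁻ : ∀ {P : Fin n → Set} (P? : Decidable P) {x} → x ∈ select P? → P x
∈-select⁻ P? {Fin.zero} x∈ with P? Fin.zero | x∈
... | yes p | here = p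
∈-select⁻ P? {Fin.suc x} (there x∈) = ∈-select⁻ (P? ∘ Fin.suc) x∈

𝟙 : {P : Set} → Dec P → ℕ
𝟙 (yes _) = 1
𝟙 (no _)  = 0

δ : ℕ → ℕ → ℕ
δ a t = 𝟙 (a ≟ t)

module _ {P Q : Set} where

  𝟙-cong : (d : Dec P) (e : Dec Q) → (P → Q) → (Q → P) → 𝟙 d ≡ 𝟙 e
  𝟙-cong (yes _) (yes _) _ _ = refl
  𝟙-cong (yes p) (no ¬q) f _ = ⊥-elim (¬q (f p))
  𝟙-cong (no ¬p) (yes q) _ g = ⊥-elim (¬p (g q))
  𝟙-cong (no _)  (no _)  _ _ = refl

  𝟙-× : (d : Dec P) (e : Dec Q) → 𝟙 (d ×-dec e) ≡ 𝟙 d * 𝟙 e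
  𝟙-× (yes _) (yes _) = refl
  𝟙-× (yes _) (no _)  = refl
  𝟙-× (no _)  _       = refl

module _ {P : Set} where

  𝟙-yes : (d : Dec P) → P → 𝟙 d ≡ 1
  𝟙-yes (yes _) _ = refl
  𝟙-yes (no ¬p) p = ⊥-elim (¬p p)

  𝟙-no : (d : Dec P) → ¬ P → 𝟙 d ≡ 0
  𝟙-no (yes p) ¬p = ⊥-elim (¬p p)
  𝟙-no (no _)  _  = refl

  𝟙*-cong : (d : Dec P) {x y : ℕ} → (P → x ≡ y) → 𝟙 d * x ≡ 𝟙 d * y
  𝟙*-cong (yes p) h = cong (1 *_) (h p)
  𝟙*-cong (no _)  _ = refl

  𝟙*-zero : (d : Dec P) {x : ℕ} → (P → x ≡ 0) → 𝟙 d * x ≡ 0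
  𝟙*-zero d h = trans (𝟙*-cong d h) (*-zeroʳ (𝟙 d))

𝟙-≡-sym : ∀ m n → 𝟙 (m ≟ n) ≡ 𝟙 (n ≟ m)
𝟙-≡-sym m n = 𝟙-cong (m ≟ n) (n ≟ m) sym sym

∑⊆ : ∀ {n} → Subset n → (Subset n → ℕ) → ℕ
∑⊆ []            f = f []
∑⊆ (inside ∷ U)  f = ∑⊆ U (λ X → f (inside ∷ X)) + ∑⊆ U (λ X → f (outside ∷ X))
∑⊆ (outside ∷ U) f = ∑⊆ U (λ X → f (outside ∷ X))

infix 5 ∑⊆
syntax ∑⊆ U (λ X → e) = ∑[ X ⊆ U ] e

∑⊆-cong : ∀ (U : Subset n) {f g : Subset n → ℕ} →
          (∀ X → X ⊆ U → f X ≡ g X) → ∑⊆ U f ≡ ∑⊆ U g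
∑⊆-cong []            h = h [] λ ()
∑⊆-cong (inside ∷ U)  h = cong₂ _+_ (∑⊆-cong U λ X X⊆U → h _ (in⊆in X⊆U))
                                    (∑⊆-cong U λ X X⊆U → h _ (out⊆ X⊆U))
∑⊆-cong (outside ∷ U) h = ∑⊆-cong U λ X X⊆U → h _ (out⊆ X⊆U)

∑⊆-zero : ∀ (U : Subset n) {f : Subset n → ℕ} → (∀ X → X ⊆ U → f X ≡ 0) → ∑⊆ U f ≡ 0
∑⊆-zero []            h = h [] λ ()
∑⊆-zero (inside ∷ U)  h = cong₂ _+_ (∑⊆-zero U λ X X⊆U → h _ (in⊆in X⊆U))
                                    (∑⊆-zero U λ X X⊆U → h _ (out⊆ X⊆U))
∑⊆-zero (outside ∷ U) h = ∑⊆-zero U λ X X⊆U → h _ (out⊆ X⊆U)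

∑⊆-distrib-+ : ∀ (U : Subset n) (f g : Subset n → ℕ) →
               ∑[ X ⊆ U ] (f X + g X) ≡ ∑⊆ U f + ∑⊆ U g
∑⊆-distrib-+ []            f g = refl
∑⊆-distrib-+ (inside ∷ U)  f g =
  trans (cong₂ _+_ (∑⊆-distrib-+ U _ _) (∑⊆-distrib-+ U _ _))
        (+-interchange (∑⊆ U (f ∘ (inside ∷_))) _ _ _)
∑⊆-distrib-+ (outside ∷ U) f g = ∑⊆-distrib-+ U _ _

*-distribˡ-∑⊆ : ∀ (U : Subset n) c (f : Subset n → ℕ) → c * ∑⊆ U f ≡ ∑[ X ⊆ U ] (c * f X)
*-distribˡ-∑⊆ []            c f = refl
*-distribˡ-∑⊆ (inside ∷ U)  c f =
  trans (*-distribˡ-+ c _ _) (cong₂ _+_ (*-distribˡ-∑⊆ U c _) (*-distribˡ-∑⊆ U c _))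
*-distribˡ-∑⊆ (outside ∷ U) c f = *-distribˡ-∑⊆ U c _

*-distribʳ-∑⊆ : ∀ (U : Subset n) c (f : Subset n → ℕ) → ∑⊆ U f * c ≡ ∑[ X ⊆ U ] (f X * c)
*-distribʳ-∑⊆ U c f =
  trans (*-comm (∑⊆ U f) c) (trans (*-distribˡ-∑⊆ U c f) (∑⊆-cong U λ X _ → *-comm c (f X)))

∑⊆-comm : ∀ {m} (U : Subset n) (V : Subset m) (f : Subset n → Subset m → ℕ) →
          ∑[ X ⊆ U ] ∑[ Y ⊆ V ] f X Y ≡ ∑[ Y ⊆ V ] ∑[ X ⊆ U ] f X Y
∑⊆-comm []            V f = refl
∑⊆-comm (inside ∷ U)  V f =
  trans (cong₂ _+_ (∑⊆-comm U V _) (∑⊆-comm U V _)) (sym (∑⊆-distrib-+ V _ _))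
∑⊆-comm (outside ∷ U) V f = ∑⊆-comm U V _

∑⊆-sum-comm : ∀ {k} (U : Subset n) (f : Subset n → Fin k → ℕ) →
              ∑[ X ⊆ U ] sum (f X) ≡ sum (λ j → ∑[ X ⊆ U ] f X j)
∑⊆-sum-comm {k = zero}  U f = ∑⊆-zero U λ _ _ → refl
∑⊆-sum-comm {k = suc k} U f =
  trans (∑⊆-distrib-+ U _ _) (cong (∑⊆ U (λ X → f X Fin.zero) +_) (∑⊆-sum-comm U λ X → f X ∘ Fin.suc))

outside≢inside : ∀ {X Y : Subset n} → outside ∷ X ≢ inside ∷ Y
outside≢inside ()

∑⊆-⊥ : ∀ (f : Subset n → ℕ) → ∑⊆ ⊥ f ≡ f ⊥
∑⊆-⊥ {zero}  f = refl
∑⊆-⊥ {suc n} f = ∑⊆-⊥ {n} (f ∘ (outside ∷_))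

∑⊆-δ : ∀ (U : Subset n) {P : Subset n → Set} (P? : Decidable P) (f : Subset n → ℕ) X₀ →
       X₀ ⊆ U → P X₀ → (∀ X → X ⊆ U → P X → X ≡ X₀) → ∑[ X ⊆ U ] (𝟙 (P? X) * f X) ≡ f X₀
∑⊆-δ [] P? f [] _ p _ = trans (cong (_* f []) (𝟙-yes (P? []) p)) (+-identityʳ _)
∑⊆-δ (inside ∷ U) P? f (inside ∷ X₀) X₀⊆ p uniq =
  trans (cong₂ _+_ (∑⊆-δ U (P? ∘ (inside ∷_)) (f ∘ (inside ∷_)) X₀ (drop-∷-⊆ X₀⊆) p
                         λ X X⊆U q → ∷-injectiveʳ (uniq _ (in⊆in X⊆U) q))
                   (∑⊆-zero U λ X X⊆U → 𝟙*-zero (P? _) λ q → ⊥-elim (outside≢inside (uniq _ (out⊆ X⊆U) q))))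
        (+-identityʳ _)
∑⊆-δ (inside ∷ U) P? f (outside ∷ X₀) X₀⊆ p uniq =
  cong₂ _+_ (∑⊆-zero U λ X X⊆U → 𝟙*-zero (P? _) λ q → ⊥-elim (outside≢inside (sym (uniq _ (in⊆in X⊆U) q))))
            (∑⊆-δ U (P? ∘ (outside ∷_)) (f ∘ (outside ∷_)) X₀ (drop-∷-⊆ X₀⊆) p
                  λ X X⊆U q → ∷-injectiveʳ (uniq _ (out⊆ X⊆U) q))
∑⊆-δ (outside ∷ U) P? f (inside ∷ X₀) X₀⊆ p uniq with () ← X₀⊆ here
∑⊆-δ (outside ∷ U) P? f (outside ∷ X₀) X₀⊆ p uniq =
  ∑⊆-δ U (P? ∘ (outside ∷_)) (f ∘ (outside ∷_)) X₀ (drop-∷-⊆ X₀⊆) p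
       λ X X⊆U q → ∷-injectiveʳ (uniq _ (out⊆ X⊆U) q)

∑⊆-∪ : ∀ (U V : Subset n) (f : Subset n → ℕ) → U ∩ V ≡ ⊥ →
       ∑⊆ (U ∪ V) f ≡ ∑[ Y ⊆ U ] ∑[ J ⊆ V ] f (Y ∪ J)
∑⊆-∪ []            []            f _  = refl
∑⊆-∪ (inside ∷ U)  (inside ∷ V)  f ()
∑⊆-∪ (inside ∷ U)  (outside ∷ V) f UV =
  cong₂ _+_ (∑⊆-∪ U V _ (∷-injectiveʳ UV)) (∑⊆-∪ U V _ (∷-injectiveʳ UV))
∑⊆-∪ (outside ∷ U) (inside ∷ V)  f UV =
  trans (cong₂ _+_ (∑⊆-∪ U V _ (∷-injectiveʳ UV)) (∑⊆-∪ U V _ (∷-injectiveʳ UV))) (sym (∑⊆-distrib-+ U _ _))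
∑⊆-∪ (outside ∷ U) (outside ∷ V) f UV = ∑⊆-∪ U V _ (∷-injectiveʳ UV)

∑⊆-size : ∀ (U : Subset n) s → ∑[ X ⊆ U ] δ ∣ X ∣ s ≡ ∣ U ∣ choose s
∑⊆-size []            zero    = refl
∑⊆-size []            (suc s) = refl
∑⊆-size (inside ∷ U)  zero    = cong₂ _+_ (∑⊆-zero U λ X _ → 𝟙-no (suc ∣ X ∣ ≟ 0) λ ()) (∑⊆-size U 0)
∑⊆-size (inside ∷ U)  (suc s) =
  trans (cong₂ _+_ (trans (∑⊆-cong U λ X _ → 𝟙-cong (suc ∣ X ∣ ≟ suc s) (∣ X ∣ ≟ s) suc-injective (cong suc))
                          (∑⊆-size U s))
                   (∑⊆-size U (suc s)))
        (nCk+nC[k+1]≡[n+1]C[k+1] ∣ U ∣ s)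
∑⊆-size (outside ∷ U) s       = ∑⊆-size U s

length-filter-map : ∀ {A B : Set} {P : Pred B 0ℓ} (P? : Decidable P) (f : A → B) xs →
                    length (filter P? (map f xs)) ≡ length (filter (P? ∘ f) xs)
length-filter-map P? f []       = refl
length-filter-map P? f (x ∷ xs) with does (P? (f x))
... | true  = cong suc (length-filter-map P? f xs)
... | false = length-filter-map P? f xs

count≡∑⊆ : ∀ {P : Pred (Subset n) 0ℓ} (P? : Decidable P) → count P? ≡ ∑[ X ⊆ ⊤ ] 𝟙 (P? X)
count≡∑⊆ {zero}  P? with P? []
... | yes _ = refl
... | no _  = refl
count≡∑⊆ {suc n} P? =
  begin
    length (filter P? (map (inside ∷_) (allSubsets n) ++ map (outside ∷_) (allSubsets n)))
  ≡⟨ cong length (filter-++ P? (map (inside ∷_) (allSubsets n)) _) ⟩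
    length (filter P? (map (inside ∷_) (allSubsets n)) ++ filter P? (map (outside ∷_) (allSubsets n)))
  ≡⟨ length-++ (filter P? (map (inside ∷_) (allSubsets n))) ⟩
    length (filter P? (map (inside ∷_) (allSubsets n))) + length (filter P? (map (outside ∷_) (allSubsets n)))
  ≡⟨ cong₂ _+_ (length-filter-map P? (inside ∷_) (allSubsets n))
               (length-filter-map P? (outside ∷_) (allSubsets n)) ⟩
    count (P? ∘ (inside ∷_)) + count (P? ∘ (outside ∷_))
  ≡⟨ cong₂ _+_ (count≡∑⊆ (P? ∘ (inside ∷_))) (count≡∑⊆ (P? ∘ (outside ∷_))) ⟩
    ∑[ X ⊆ ⊤ ] 𝟙 (P? X)
  ∎
  where open ≡-Reasoning

sum-zero : ∀ {k} {f : Fin k → ℕ} → (∀ j → f j ≡ 0) → sum f ≡ 0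
sum-zero {k} h = trans (sum-cong-≗ h) (sum-replicate-zero k)

sum-δ : ∀ {k} {P : Fin k → Set} (P? : Decidable P) (f : Fin k → ℕ) j₀ →
        P j₀ → (∀ j → P j → j ≡ j₀) → sum (λ j → 𝟙 (P? j) * f j) ≡ f j₀
sum-δ P? f Fin.zero p uniq =
  trans (cong₂ _+_ (trans (cong (_* f Fin.zero) (𝟙-yes (P? Fin.zero) p)) (+-identityʳ _))
                   (sum-zero λ j → 𝟙*-zero (P? (Fin.suc j)) λ q → ⊥-elim (Fin.0≢1+n (sym (uniq _ q)))))
        (+-identityʳ _)
sum-δ P? f (Fin.suc j₀) p uniq =
  cong₂ _+_ (𝟙*-zero (P? Fin.zero) λ q → ⊥-elim (Fin.0≢1+n (uniq _ q)))
            (sum-δ (P? ∘ Fin.suc) (f ∘ Fin.suc) j₀ p λ j q → Fin.suc-injective (uniq _ q))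

sum-bijection : ∀ {k k′} (φ : Fin k ⤖ Fin k′) (f : Fin k′ → ℕ) → sum f ≡ sum (f ∘ Bijection.to φ)
sum-bijection φ f = ∑-permute f (⤖⇒↔ φ)

Distinct₂? : ∀ {k} (a b : Fin k) j → Dec (j ≢ a × j ≢ b)
Distinct₂? a b j = ¬? (j Fin.≟ a) ×-dec ¬? (j Fin.≟ b)

sum-extract₂ : ∀ {k} (f : Fin k → ℕ) a b → a ≢ b →
               sum f ≡ f a + (f b + sum (λ j → 𝟙 (Distinct₂? a b j) * f j))
sum-extract₂ f a b a≢b =
  begin
    sum f
  ≡⟨ sum-cong-≗ (λ j → split j (j Fin.≟ a) (j Fin.≟ b)) ⟩
    sum (λ j → 𝟙 (j Fin.≟ a) * f j + (𝟙 (j Fin.≟ b) * f j + 𝟙 (Distinct₂? a b j) * f j))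
  ≡⟨ ∑-distrib-+ (λ j → 𝟙 (j Fin.≟ a) * f j) _ ⟩
    sum (λ j → 𝟙 (j Fin.≟ a) * f j) + sum (λ j → 𝟙 (j Fin.≟ b) * f j + 𝟙 (Distinct₂? a b j) * f j)
  ≡⟨ cong (_ +_) (∑-distrib-+ (λ j → 𝟙 (j Fin.≟ b) * f j) _) ⟩
    sum (λ j → 𝟙 (j Fin.≟ a) * f j) + (sum (λ j → 𝟙 (j Fin.≟ b) * f j) + rest)
  ≡⟨ cong₂ (λ x y → x + (y + rest)) (sum-δ (Fin._≟ a) f a refl λ _ e → e)
                                     (sum-δ (Fin._≟ b) f b refl λ _ e → e) ⟩
    f a + (f b + rest)
  ∎
  where
  open ≡-Reasoning
  rest : ℕ
  rest = sum (λ j → 𝟙 (Distinct₂? a b j) * f j)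
  split : ∀ j (j≟a : Dec (j ≡ a)) (j≟b : Dec (j ≡ b)) →
          f j ≡ 𝟙 j≟a * f j + (𝟙 j≟b * f j + 𝟙 (¬? j≟a ×-dec ¬? j≟b) * f j)
  split j (yes refl) (yes refl) = ⊥-elim (a≢b refl)
  split j (yes _)    (no _)     = sym (trans (+-identityʳ _) (+-identityʳ _))
  split j (no _)     (yes _)    = sym (trans (+-identityʳ _) (+-identityʳ _))
  split j (no _)     (no _)     = sym (+-identityʳ _)

∑≤ : ℕ → (ℕ → ℕ) → ℕ
∑≤ N f = sum {suc N} (f ∘ toℕ)

infix 5 ∑≤
syntax ∑≤ N (λ t → e) = ∑[ t ≤ N ] e

∑≤-cong : ∀ N {f g : ℕ → ℕ} → (∀ t → t ≤ N → f t ≡ g t) → ∑≤ N f ≡ ∑≤ N g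
∑≤-cong N h = sum-cong-≗ λ i → h (toℕ i) (Fin.toℕ≤pred[n] i)

*-distribˡ-∑≤ : ∀ N c (f : ℕ → ℕ) → c * ∑≤ N f ≡ ∑[ t ≤ N ] (c * f t)
*-distribˡ-∑≤ N c f = *-distribˡ-sum {suc N} c (f ∘ toℕ)

∑⊆-∑≤-comm : ∀ (U : Subset n) N (f : Subset n → ℕ → ℕ) →
             ∑[ X ⊆ U ] ∑[ t ≤ N ] f X t ≡ ∑[ t ≤ N ] ∑[ X ⊆ U ] f X t
∑⊆-∑≤-comm U N f = ∑⊆-sum-comm {k = suc N} U λ X i → f X (toℕ i)

∑≤-δ : ∀ N (f : ℕ → ℕ) s → s ≤ N → ∑[ t ≤ N ] (𝟙 (t ≟ s) * f t) ≡ f s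
∑≤-δ N f s s≤N =
  trans (sum-δ (λ i → toℕ i ≟ s) (f ∘ toℕ) (fromℕ< (s≤s s≤N)) (Fin.toℕ-fromℕ< _)
               λ i e → Fin.toℕ-injective (trans e (sym (Fin.toℕ-fromℕ< _))))
        (cong f (Fin.toℕ-fromℕ< _))

∑≤-δ-beyond : ∀ N (f : ℕ → ℕ) s → N < s → ∑[ t ≤ N ] (𝟙 (t ≟ s) * f t) ≡ 0
∑≤-δ-beyond N f s N<s =
  sum-zero λ i → 𝟙*-zero (toℕ i ≟ s) {f (toℕ i)} λ e →
    ⊥-elim (<⇒≱ N<s (subst (_≤ N) e (Fin.toℕ≤pred[n] i)))

infixl 7 _⋆_
_⋆_ : (ℕ → ℕ) → (ℕ → ℕ) → ℕ → ℕ
(f ⋆ g) s = ∑[ t ≤ s ] (f t * g (s ∸ t))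

δ-+ : ∀ a b s → δ (a + b) s ≡ (δ a ⋆ δ b) s
δ-+ a b s with a ≤? s
... | yes a≤s =
  begin
    𝟙 (a + b ≟ s)
  ≡⟨ 𝟙-cong (a + b ≟ s) (b ≟ s ∸ a) (λ e → trans (sym (m+n∸m≡n a b)) (cong (_∸ a) e))
                                     (λ e → trans (cong (a +_) e) (m+[n∸m]≡n a≤s)) ⟩
    δ b (s ∸ a)
  ≡⟨ ∑≤-δ s (λ t → δ b (s ∸ t)) a a≤s ⟨
    ∑[ t ≤ s ] (𝟙 (t ≟ a) * δ b (s ∸ t))
  ≡⟨ ∑≤-cong s (λ t _ → cong (_* δ b (s ∸ t)) (𝟙-≡-sym t a)) ⟩
    (δ a ⋆ δ b) s
  ∎
  where open ≡-Reasoning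
... | no a≰s =
  begin
    𝟙 (a + b ≟ s)
  ≡⟨ 𝟙-no (a + b ≟ s) (λ e → a≰s (subst (a ≤_) e (m≤m+n a b))) ⟩
    0
  ≡⟨ ∑≤-δ-beyond s (λ t → δ b (s ∸ t)) a (≰⇒> a≰s) ⟨
    ∑[ t ≤ s ] (𝟙 (t ≟ a) * δ b (s ∸ t))
  ≡⟨ ∑≤-cong s (λ t _ → cong (_* δ b (s ∸ t)) (𝟙-≡-sym t a)) ⟩
    (δ a ⋆ δ b) s
  ∎
  where open ≡-Reasoning

sizes : Subset n → (Subset n → ℕ) → ℕ → ℕ
sizes U w s = ∑[ X ⊆ U ] (w X * δ ∣ X ∣ s)

sizes-⋆ : ∀ (U V : Subset n) (u v : Subset n → ℕ) s →
          ∑[ Y ⊆ U ] (u Y * (∑[ J ⊆ V ] v J * δ (∣ Y ∣ + ∣ J ∣) s)) ≡ (sizes U u ⋆ sizes V v) s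
sizes-⋆ U V u v s =
  begin
    ∑[ Y ⊆ U ] (u Y * (∑[ J ⊆ V ] v J * δ (∣ Y ∣ + ∣ J ∣) s))
  ≡⟨ ∑⊆-cong U (λ Y _ → cong (u Y *_) (∑⊆-cong V λ J _ → cong (v J *_) (δ-+ ∣ Y ∣ ∣ J ∣ s))) ⟩
    ∑[ Y ⊆ U ] (u Y * (∑[ J ⊆ V ] v J * (∑[ t ≤ s ] (δ ∣ Y ∣ t) * δ ∣ J ∣ (s ∸ t))))
  ≡⟨ ∑⊆-cong U (λ Y _ → cong (u Y *_) (inner Y)) ⟩
    ∑[ Y ⊆ U ] (u Y * (∑[ t ≤ s ] (δ ∣ Y ∣ t) * sizes V v (s ∸ t)))
  ≡⟨ ∑⊆-cong U (λ Y _ → trans (*-distribˡ-∑≤ s (u Y) (λ t → (δ ∣ Y ∣ t) * sizes V v (s ∸ t)))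
                            (∑≤-cong s λ t _ → sym (*-assoc (u Y) (δ ∣ Y ∣ t) (sizes V v (s ∸ t))))) ⟩
    ∑[ Y ⊆ U ] ∑[ t ≤ s ] (u Y * (δ ∣ Y ∣ t) * sizes V v (s ∸ t))
  ≡⟨ ∑⊆-∑≤-comm U s (λ Y t → u Y * (δ ∣ Y ∣ t) * sizes V v (s ∸ t)) ⟩
    ∑[ t ≤ s ] ∑[ Y ⊆ U ] (u Y * (δ ∣ Y ∣ t) * sizes V v (s ∸ t))
  ≡⟨ ∑≤-cong s (λ t _ → sym (*-distribʳ-∑⊆ U (sizes V v (s ∸ t)) (λ Y → u Y * δ ∣ Y ∣ t))) ⟩
    (sizes U u ⋆ sizes V v) s
  ∎
  where
  open ≡-Reasoning
  inner : ∀ Y → ∑[ J ⊆ V ] v J * (∑[ t ≤ s ] (δ ∣ Y ∣ t) * δ ∣ J ∣ (s ∸ t)) ≡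
                ∑[ t ≤ s ] ((δ ∣ Y ∣ t) * sizes V v (s ∸ t))
  inner Y =
    begin
      ∑[ J ⊆ V ] v J * (∑[ t ≤ s ] (δ ∣ Y ∣ t) * δ ∣ J ∣ (s ∸ t))
    ≡⟨ ∑⊆-cong V (λ J _ → trans (*-distribˡ-∑≤ s (v J) (λ t → (δ ∣ Y ∣ t) * δ ∣ J ∣ (s ∸ t)))
                              (∑≤-cong s λ t _ → x*yz≡y*xz (v J) (δ ∣ Y ∣ t) (δ ∣ J ∣ (s ∸ t)))) ⟩
      ∑[ J ⊆ V ] ∑[ t ≤ s ] ((δ ∣ Y ∣ t) * (v J * δ ∣ J ∣ (s ∸ t)))
    ≡⟨ ∑⊆-∑≤-comm V s (λ J t → (δ ∣ Y ∣ t) * (v J * δ ∣ J ∣ (s ∸ t))) ⟩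
      ∑[ t ≤ s ] ∑[ J ⊆ V ] ((δ ∣ Y ∣ t) * (v J * δ ∣ J ∣ (s ∸ t)))
    ≡⟨ ∑≤-cong s (λ t _ → sym (*-distribˡ-∑⊆ V (δ ∣ Y ∣ t) (λ J → v J * δ ∣ J ∣ (s ∸ t)))) ⟩
      ∑[ t ≤ s ] ((δ ∣ Y ∣ t) * sizes V v (s ∸ t))
    ∎

sizes-⊥ : ∀ (U : Subset n) w s → U ≡ ⊥ → sizes U w s ≡ w ⊥ * δ 0 s
sizes-⊥ {n} _ w s refl = trans (∑⊆-⊥ (λ X → w X * δ ∣ X ∣ s)) (cong (λ m → w ⊥ * δ m s) (∣⊥∣≡0 n))

∑⊆-by-size : ∀ N → n ≤ N → (U : Subset n) (w : Subset n → ℕ) (f : ℕ → ℕ) →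
             ∑[ X ⊆ U ] (w X * f ∣ X ∣) ≡ ∑[ s ≤ N ] (sizes U w s * f s)
∑⊆-by-size N n≤N U w f =
  begin
    ∑[ X ⊆ U ] (w X * f ∣ X ∣)
  ≡⟨ ∑⊆-cong U (λ X _ → cong (w X *_) (sym (∑≤-δ N f ∣ X ∣ (≤-trans (∣p∣≤n X) n≤N)))) ⟩
    ∑[ X ⊆ U ] (w X * (∑[ s ≤ N ] 𝟙 (s ≟ ∣ X ∣) * f s))
  ≡⟨ ∑⊆-cong U (λ X _ → trans (*-distribˡ-∑≤ N (w X) (λ s → 𝟙 (s ≟ ∣ X ∣) * f s))
                              (∑≤-cong N λ s _ → trans (cong (λ d → w X * (d * f s)) (𝟙-≡-sym s ∣ X ∣))
                                                       (sym (*-assoc (w X) (δ ∣ X ∣ s) (f s))))) ⟩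
    ∑[ X ⊆ U ] ∑[ s ≤ N ] (w X * (δ ∣ X ∣ s) * f s)
  ≡⟨ ∑⊆-∑≤-comm U N (λ X s → w X * (δ ∣ X ∣ s) * f s) ⟩
    ∑[ s ≤ N ] ∑[ X ⊆ U ] (w X * (δ ∣ X ∣ s) * f s)
  ≡⟨ ∑≤-cong N (λ s _ → sym (*-distribʳ-∑⊆ U (f s) (λ X → w X * δ ∣ X ∣ s))) ⟩
    ∑[ s ≤ N ] (sizes U w s * f s)
  ∎
  where open ≡-Reasoning

∑⊆-⋆ : ∀ (U : Subset n) (w : Subset n → ℕ) (f : Subset n → ℕ → ℕ) (g : ℕ → ℕ) s →
       ∑[ F ⊆ U ] w F * (f F ⋆ g) s ≡ ((λ t → ∑[ F ⊆ U ] w F * f F t) ⋆ g) s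
∑⊆-⋆ U w f g s =
  begin
    ∑[ F ⊆ U ] w F * (f F ⋆ g) s
  ≡⟨ ∑⊆-cong U (λ F _ → trans (*-distribˡ-∑≤ s (w F) (λ t → f F t * g (s ∸ t)))
                              (∑≤-cong s λ t _ → sym (*-assoc (w F) (f F t) (g (s ∸ t))))) ⟩
    ∑[ F ⊆ U ] ∑[ t ≤ s ] w F * f F t * g (s ∸ t)
  ≡⟨ ∑⊆-∑≤-comm U s (λ F t → w F * f F t * g (s ∸ t)) ⟩
    ∑[ t ≤ s ] ∑[ F ⊆ U ] w F * f F t * g (s ∸ t)
  ≡⟨ ∑≤-cong s (λ t _ → sym (*-distribʳ-∑⊆ U (g (s ∸ t)) (λ F → w F * f F t))) ⟩
    ((λ t → ∑[ F ⊆ U ] w F * f F t) ⋆ g) s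
  ∎
  where open ≡-Reasoning

∑⊆-⋆ʳ : ∀ (U : Subset n) (w : Subset n → ℕ) (f : ℕ → ℕ) (g : Subset n → ℕ → ℕ) s →
        ∑[ H ⊆ U ] w H * (f ⋆ g H) s ≡ (f ⋆ (λ t → ∑[ H ⊆ U ] w H * g H t)) s
∑⊆-⋆ʳ U w f g s =
  begin
    ∑[ H ⊆ U ] w H * (f ⋆ g H) s
  ≡⟨ ∑⊆-cong U (λ H _ → trans (*-distribˡ-∑≤ s (w H) (λ t → f t * g H (s ∸ t)))
                              (∑≤-cong s λ t _ → x*yz≡y*xz (w H) (f t) (g H (s ∸ t)))) ⟩
    ∑[ H ⊆ U ] ∑[ t ≤ s ] f t * (w H * g H (s ∸ t))
  ≡⟨ ∑⊆-∑≤-comm U s (λ H t → f t * (w H * g H (s ∸ t))) ⟩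
    ∑[ t ≤ s ] ∑[ H ⊆ U ] f t * (w H * g H (s ∸ t))
  ≡⟨ ∑≤-cong s (λ t _ → sym (*-distribˡ-∑⊆ U (f t) (λ H → w H * g H (s ∸ t)))) ⟩
    (f ⋆ (λ t → ∑[ H ⊆ U ] w H * g H t)) s
  ∎
  where open ≡-Reasoning

⋆-zeroˡ : ∀ f g s → (∀ t → f t ≡ 0) → (f ⋆ g) s ≡ 0
⋆-zeroˡ f g s f≡0 = sum-zero {suc s} λ i → cong (_* g (s ∸ toℕ i)) (f≡0 (toℕ i))

δ0-⋆ : ∀ f s → (δ 0 ⋆ f) s ≡ f s
δ0-⋆ f s = trans (∑≤-cong s λ t _ → cong (_* f (s ∸ t)) (𝟙-≡-sym 0 t)) (∑≤-δ s (λ t → f (s ∸ t)) 0 z≤n)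

⋆-δ0 : ∀ f s → (f ⋆ δ 0) s ≡ f s
⋆-δ0 f s = trans (∑≤-cong s λ t t≤s → trans (cong (f t *_) (δ0-∸ t≤s)) (*-comm (f t) (𝟙 (t ≟ s))))
                 (∑≤-δ s f s ≤-refl)
  where
  δ0-∸ : ∀ {t} → t ≤ s → δ 0 (s ∸ t) ≡ 𝟙 (t ≟ s)
  δ0-∸ {t} t≤s = 𝟙-cong (0 ≟ s ∸ t) (t ≟ s) (λ 0≡s∸t → ≤-antisym t≤s (m∸n≡0⇒m≤n (sym 0≡s∸t)))
                                           (λ { refl → sym (n∸n≡0 t) })

module Flats {n} (M : Matroid n) where

  r : Subset n → ℕ
  r = rank M

  r-mono : ∀ {X Y} → X ⊆ Y → r X ≤ r Y
  r-mono = rank-mono M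

  r⊥≡0 : r ⊥ ≡ 0
  r⊥≡0 = n≤0⇒n≡0 (≤-trans (rank-card M ⊥) (≤-reflexive (∣⊥∣≡0 n)))

  r-⊆∪-≤ : ∀ {W} X Y → W ⊆ X ∪ Y → r W ≤ r X + ∣ Y ∣
  r-⊆∪-≤ X Y W⊆ =
    ≤-trans (r-mono W⊆) (≤-trans (m≤m+n _ _) (≤-trans (rank-sub M X Y) (+-monoʳ-≤ (r X) (rank-card M Y))))

  r-submodular-⊆ : ∀ {A B} D → A ⊆ B → r (B ∪ D) + r A ≤ r (A ∪ D) + r B
  r-submodular-⊆ {A} {B} D A⊆B =
    ≤-trans (+-mono-≤ (r-mono (∪-least (q⊆p∪q (A ∪ D) B) (p⊆p∪q B ∘ q⊆p∪q A D)))
                      (r-mono λ x∈A → x∈p∩q⁺ (p⊆p∪q D x∈A , A⊆B x∈A)))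
            (rank-sub M (A ∪ D) B)

  r-∪-cong : ∀ {A B} D → A ⊆ B → r A ≡ r B → r (A ∪ D) ≡ r (B ∪ D)
  r-∪-cong {A} {B} D A⊆B rA≡rB =
    ≤-antisym (r-mono (∪-mono A⊆B ⊆-refl))
              (+-cancelʳ-≤ (r A) _ _ (subst (λ x → r (B ∪ D) + r A ≤ r (A ∪ D) + x) (sym rA≡rB)
                                            (r-submodular-⊆ D A⊆B)))

  flat-maximal : ∀ {A B} → IsFlat M A → A ⊆ B → r A ≡ r B → B ⊆ A
  flat-maximal {A} {B} A-flat A⊆B rA≡rB {x} x∈B with x ∈? A
  ... | yes x∈A = x∈A
  ... | no  x∉A = ⊥-elim (<⇒≱ (A-flat x x∉A) (begin
        r (A ∪ ⁅ x ⁆) ≤⟨ r-mono (∪-least A⊆B (⁅x⁆⊆ x∈B)) ⟩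
        r B           ≡⟨ rA≡rB ⟨
        r A           ∎))
    where open ≤-Reasoning

  flat-spanned-∈ : ∀ {A G e} → A ⊆ G → IsFlat M G → r (A ∪ ⁅ e ⁆) ≡ r A → e ∈ G
  flat-spanned-∈ {A} {G} {e} A⊆G G-flat e-spanned with e ∈? G
  ... | yes e∈G = e∈G
  ... | no  e∉G = ⊥-elim (<⇒≱ (G-flat e e∉G) (+-cancelʳ-≤ (r A) _ _ (begin
        r (G ∪ ⁅ e ⁆) + r A ≤⟨ r-submodular-⊆ ⁅ e ⁆ A⊆G ⟩
        r (A ∪ ⁅ e ⁆) + r G ≡⟨ cong (_+ r G) e-spanned ⟩
        r A + r G           ≡⟨ +-comm (r A) (r G) ⟩
        r G + r A           ∎)))
    where open ≤-Reasoning

  r-∪-spanned : ∀ A D → (∀ e → e ∈ D → r (A ∪ ⁅ e ⁆) ≡ r A) → r (A ∪ D) ≡ r A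
  r-∪-spanned A = remove-induction (λ D → (∀ e → e ∈ D → r (A ∪ ⁅ e ⁆) ≡ r A) → r (A ∪ D) ≡ r A)
    (λ _ → cong r (∪-identityʳ A)) step
    where
    step : ∀ D d → d ∈ D → ((∀ e → e ∈ D - d → r (A ∪ ⁅ e ⁆) ≡ r A) → r (A ∪ (D - d)) ≡ r A) →
           (∀ e → e ∈ D → r (A ∪ ⁅ e ⁆) ≡ r A) → r (A ∪ D) ≡ r A
    step D d d∈D ih spanned = ≤-antisym (begin
        r (A ∪ D)                 ≤⟨ r-mono (∪-least (p⊆p∪q ⁅ d ⁆ ∘ p⊆p∪q (D - d))
                                                     (∪-mono (q⊆p∪q A (D - d)) ⊆-refl ∘ ∈-─-∪ ⁅ d ⁆ D)) ⟩
        r ((A ∪ (D - d)) ∪ ⁅ d ⁆) ≡⟨ r-∪-cong ⁅ d ⁆ (p⊆p∪q (D - d)) (sym rA∪D-d) ⟨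
        r (A ∪ ⁅ d ⁆)             ≡⟨ spanned d d∈D ⟩
        r A                       ∎)
      (r-mono (p⊆p∪q D))
      where
      open ≤-Reasoning
      rA∪D-d : r (A ∪ (D - d)) ≡ r A
      rA∪D-d = ih λ e e∈ → spanned e (p─q⊆p D ⁅ d ⁆ e∈)

  cl : Subset n → Subset n
  cl A = select λ e → r (A ∪ ⁅ e ⁆) ≟ r A

  ∈-cl⁺ : ∀ {A e} → r (A ∪ ⁅ e ⁆) ≡ r A → e ∈ cl A
  ∈-cl⁺ {A} = ∈-select⁺ λ e → r (A ∪ ⁅ e ⁆) ≟ r A

  ∈-cl⁻ : ∀ {A e} → e ∈ cl A → r (A ∪ ⁅ e ⁆) ≡ r A
  ∈-cl⁻ {A} = ∈-select⁻ λ e → r (A ∪ ⁅ e ⁆) ≟ r A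

  cl-⊇ : ∀ A → A ⊆ cl A
  cl-⊇ A e∈A = ∈-cl⁺ (cong r (⊆-antisym (∪-least ⊆-refl (⁅x⁆⊆ e∈A))
                                        (p⊆p∪q _)))

  cl-rank : ∀ A → r (cl A) ≡ r A
  cl-rank A = ≤-antisym (≤-trans (r-mono (q⊆p∪q A (cl A))) (≤-reflexive (r-∪-spanned A (cl A) λ _ → ∈-cl⁻)))
                        (r-mono (cl-⊇ A))

  cl-flat : ∀ A → IsFlat M (cl A)
  cl-flat A e e∉cl = ≤∧≢⇒< (r-mono (p⊆p∪q ⁅ e ⁆)) λ r-eq →
    e∉cl (∈-cl⁺ (trans (r-∪-cong ⁅ e ⁆ (cl-⊇ A) (sym (cl-rank A))) (trans (sym r-eq) (cl-rank A))))

  IsColoop : Subset n → Fin n → Set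
  IsColoop K e = e ∈ K × r (K - e) < r K

  coloops : Subset n → Subset n
  coloops K = select λ e → (e ∈? K) ×-dec (r (K - e) <? r K)

  ∈-coloops⁺ : ∀ {K e} → IsColoop K e → e ∈ coloops K
  ∈-coloops⁺ {K} = ∈-select⁺ λ e → (e ∈? K) ×-dec (r (K - e) <? r K)

  ∈-coloops⁻ : ∀ {K e} → e ∈ coloops K → IsColoop K e
  ∈-coloops⁻ {K} = ∈-select⁻ λ e → (e ∈? K) ×-dec (r (K - e) <? r K)

  coloop-⊆ : ∀ {K X c} → IsColoop K c → c ∈ X → X ⊆ K → IsColoop X c
  coloop-⊆ {K} {X} {c} (c∈K , c-coloop) c∈X X⊆K = c∈X , +-cancelˡ-< (r K) _ _ (begin-strict
    r K + r (X - c)       ≡⟨ cong (λ Y → r Y + r (X - c)) (p-x∪⁅x⁆ c∈K) ⟨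
    r ((K - c) ∪ ⁅ c ⁆) + r (X - c)
                          ≤⟨ r-submodular-⊆ ⁅ c ⁆ X-c⊆K-c ⟩
    r ((X - c) ∪ ⁅ c ⁆) + r (K - c)
                          ≡⟨ cong (λ Y → r Y + r (K - c)) (p-x∪⁅x⁆ c∈X) ⟩
    r X + r (K - c)       <⟨ +-monoʳ-< (r X) c-coloop ⟩
    r X + r K             ≡⟨ +-comm (r X) (r K) ⟩
    r K + r X             ∎)
    where
    open ≤-Reasoning
    X-c⊆K-c : X - c ⊆ K - c
    X-c⊆K-c x∈ = x∈p∧x≢y⇒x∈p-y (X⊆K (p─q⊆p X ⁅ c ⁆ x∈)) (x∈p-y⇒x≢y X x∈)

  r-─-coloops : ∀ K D → (∀ c → c ∈ D → IsColoop K c) → r (K ─ D) + ∣ D ∣ ≤ r K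
  r-─-coloops K = remove-induction (λ D → (∀ c → c ∈ D → IsColoop K c) → r (K ─ D) + ∣ D ∣ ≤ r K)
    (λ _ → ≤-reflexive (trans (cong₂ _+_ (cong r (p─⊥≡p K)) (∣⊥∣≡0 n)) (+-identityʳ (r K))))
    step
    where
    step : ∀ D d → d ∈ D → ((∀ c → c ∈ D - d → IsColoop K c) → r (K ─ (D - d)) + ∣ D - d ∣ ≤ r K) →
           (∀ c → c ∈ D → IsColoop K c) → r (K ─ D) + ∣ D ∣ ≤ r K
    step D d d∈D ih all-coloops = begin
      r (K ─ D) + ∣ D ∣           ≡⟨ cong (r (K ─ D) +_) (suc∣p-x∣ D d∈D) ⟨
      r (K ─ D) + suc ∣ D - d ∣   ≡⟨ +-suc (r (K ─ D)) ∣ D - d ∣ ⟩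
      suc (r (K ─ D)) + ∣ D - d ∣ ≤⟨ +-monoˡ-≤ ∣ D - d ∣ (≤-<-trans (r-mono K─D⊆X-d)
                                                                   (proj₂ d-coloop-of-X)) ⟩
      r X + ∣ D - d ∣             ≤⟨ ih (λ c c∈ → all-coloops c (p─q⊆p D ⁅ d ⁆ c∈)) ⟩
      r K                         ∎
      where
      open ≤-Reasoning
      X : Subset n
      X = K ─ (D - d)
      d-coloop-of-X : IsColoop X d
      d-coloop-of-X = coloop-⊆ (all-coloops d d∈D)
                               (x∈p∧x∉q⇒x∈p─q (proj₁ (all-coloops d d∈D)) λ d∈ → x∈p-y⇒x≢y D d∈ refl)
                               (p─q⊆p K (D - d))
      K─D⊆X-d : K ─ D ⊆ X - d
      K─D⊆X-d {x} x∈ = x∈p∧x≢y⇒x∈p-y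
        (x∈p∧x∉q⇒x∈p─q (p─q⊆p K D x∈) λ x∈D-d → x∈p─q⇒x∉q K D x∈ (p─q⊆p D ⁅ d ⁆ x∈D-d))
        λ { refl → x∈p─q⇒x∉q K D x∈ d∈D }

module Decomposition {n} (M : Matroid n) where

  open Flats M

  Between : Subset n → Subset n → Subset n → Set
  Between F G H = IsCyclicFlat M H × F ⊆ H × H ⊆ G

  Spans : Subset n → Subset n → Subset n → Set
  Spans F H Y = r (F ∪ Y) ≡ r H

  FreeOver : Subset n → Subset n → Set
  FreeOver H J = IsFlat M (H ∪ J) × r (H ∪ J) ≡ r H + ∣ J ∣

  IsCore : Subset n → Subset n → Subset n → Subset n → Set
  IsCore F G Z H = Between F G H × Spans F H (Z ∩ H) × FreeOver H (Z ─ H)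

  between? : ∀ F G H → Dec (Between F G H)
  between? F G H = isCyclicFlat? M H ×-dec (F ⊆? H ×-dec H ⊆? G)

  spans? : ∀ F H Y → Dec (Spans F H Y)
  spans? F H Y = r (F ∪ Y) ≟ r H

  freeOver? : ∀ H J → Dec (FreeOver H J)
  freeOver? H J = isFlat? M (H ∪ J) ×-dec (r (H ∪ J) ≟ r H + ∣ J ∣)

  isCore? : ∀ F G Z H → Dec (IsCore F G Z H)
  isCore? F G Z H = between? F G H ×-dec (spans? F H (Z ∩ H) ×-dec freeOver? H (Z ─ H))

  module Core (F G Z : Subset n) (F-cyclic : IsCyclic M F) (G-flat : IsFlat M G)
              (F⊆G : F ⊆ G) (Z⊆G : Z ⊆ G) where

    K C core : Subset n
    K = cl (F ∪ Z)
    C = coloops K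
    core = K ─ C

    F∪Z⊆K : F ∪ Z ⊆ K
    F∪Z⊆K = cl-⊇ (F ∪ Z)

    core⊆K : core ⊆ K
    core⊆K = p─q⊆p K C

    C⊆K : C ⊆ K
    C⊆K = proj₁ ∘ ∈-coloops⁻

    K⊆core∪C : K ⊆ core ∪ C
    K⊆core∪C = ∈-─-∪ C K

    rK : r K ≡ r core + ∣ C ∣
    rK = ≤-antisym (r-⊆∪-≤ core C K⊆core∪C) (r-─-coloops K C λ _ → ∈-coloops⁻)

    not-coloop : ∀ {e} → e ∈ core → r K ≤ r (K - e)
    not-coloop e∈core = ≮⇒≥ λ lt → x∈p─q⇒x∉q K C e∈core (∈-coloops⁺ (core⊆K e∈core , lt))

    core-cyclic : IsCyclic M core
    core-cyclic e e∈core = ≤-antisym (r-mono (p─q⊆p core ⁅ e ⁆)) (+-cancelʳ-≤ ∣ C ∣ _ _ (begin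
      r core + ∣ C ∣       ≡⟨ rK ⟨
      r K                  ≤⟨ not-coloop e∈core ⟩
      r (K - e)            ≤⟨ r-⊆∪-≤ (core - e) C K-e⊆ ⟩
      r (core - e) + ∣ C ∣ ∎))
      where
      open ≤-Reasoning
      K-e⊆ : K - e ⊆ (core - e) ∪ C
      K-e⊆ {x} x∈ with x∈p∪q⁻ core C (K⊆core∪C (p─q⊆p K ⁅ e ⁆ x∈))
      ... | inj₁ x∈core = p⊆p∪q C (x∈p∧x≢y⇒x∈p-y x∈core (x∈p-y⇒x≢y K x∈))
      ... | inj₂ x∈C    = q⊆p∪q (core - e) C x∈C

    core-flat : IsFlat M core
    core-flat e e∉core with e ∈? C
    ... | yes e∈C = ≤-<-trans (r-mono core⊆)
                              (proj₂ (coloop-⊆ (∈-coloops⁻ e∈C) (q⊆p∪q core ⁅ e ⁆ (x∈⁅x⁆ e))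
                                               (∪-least core⊆K (⁅x⁆⊆ (C⊆K e∈C)))))
      where
      core⊆ : core ⊆ (core ∪ ⁅ e ⁆) - e
      core⊆ x∈ = x∈p∧x≢y⇒x∈p-y (p⊆p∪q ⁅ e ⁆ x∈) λ { refl → e∉core x∈ }
    ... | no  e∉C = +-cancelʳ-< ∣ C ∣ _ _ (begin-strict
      r core + ∣ C ∣           ≡⟨ rK ⟨
      r K                      <⟨ cl-flat (F ∪ Z) e (λ e∈K → e∉core (x∈p∧x∉q⇒x∈p─q e∈K e∉C)) ⟩
      r (K ∪ ⁅ e ⁆)            ≤⟨ r-⊆∪-≤ (core ∪ ⁅ e ⁆) C K∪e⊆ ⟩
      r (core ∪ ⁅ e ⁆) + ∣ C ∣ ∎)
      where
      open ≤-Reasoning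
      K∪e⊆ : K ∪ ⁅ e ⁆ ⊆ (core ∪ ⁅ e ⁆) ∪ C
      K∪e⊆ = ∪-least (∪-mono (p⊆p∪q ⁅ e ⁆) ⊆-refl ∘ K⊆core∪C) (p⊆p∪q C ∘ q⊆p∪q core ⁅ e ⁆)

    F⊆core : F ⊆ core
    F⊆core f∈F = x∈p∧x∉q⇒x∈p─q (F∪Z⊆K (p⊆p∪q Z f∈F)) λ f∈C →
      <-irrefl (F-cyclic _ f∈F) (proj₂ (coloop-⊆ (∈-coloops⁻ f∈C) f∈F (F∪Z⊆K ∘ p⊆p∪q Z)))

    core⊆G : core ⊆ G
    core⊆G x∈core = flat-spanned-∈ (∪-least F⊆G Z⊆G) G-flat (∈-cl⁻ (core⊆K x∈core))

    Z─core≡C : Z ─ core ≡ C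
    Z─core≡C = ⊆-antisym Z─core⊆C C⊆Z─core
      where
      Z─core⊆C : Z ─ core ⊆ C
      Z─core⊆C {x} x∈ with x ∈? C
      ... | yes x∈C = x∈C
      ... | no  x∉C =
        ⊥-elim (x∈p─q⇒x∉q Z core x∈
                  (x∈p∧x∉q⇒x∈p─q (F∪Z⊆K (q⊆p∪q F Z (p─q⊆p Z core x∈))) x∉C))
      C⊆Z : C ⊆ Z
      C⊆Z {c} c∈C with c ∈? Z
      ... | yes c∈Z = c∈Z
      ... | no  c∉Z = ⊥-elim (<⇒≱ (proj₂ (∈-coloops⁻ c∈C)) (begin
        r K           ≡⟨ cl-rank (F ∪ Z) ⟩
        r (F ∪ Z)     ≤⟨ r-mono (λ x∈ → x∈p∧x≢y⇒x∈p-y (F∪Z⊆K x∈) (≢c x∈)) ⟩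
        r (K - c)     ∎))
        where
        open ≤-Reasoning
        ≢c : ∀ {x} → x ∈ F ∪ Z → x ≢ c
        ≢c x∈ refl with x∈p∪q⁻ F Z x∈
        ... | inj₁ c∈F = x∈p─q⇒x∉q K C (F⊆core c∈F) c∈C
        ... | inj₂ c∈Z = c∉Z c∈Z
      C⊆Z─core : C ⊆ Z ─ core
      C⊆Z─core c∈C = x∈p∧x∉q⇒x∈p─q (C⊆Z c∈C) λ c∈core → x∈p─q⇒x∉q K C c∈core c∈C

    core∪C≡K : core ∪ C ≡ K
    core∪C≡K = ⊆-antisym (∪-least core⊆K C⊆K) K⊆core∪C

    core-isCore : IsCore F G Z core
    core-isCore = ((core-flat , core-cyclic) , F⊆core , core⊆G) , spans , free-flat , free-rank
      where
      open ≤-Reasoning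
      F∪Z⊆ : F ∪ Z ⊆ (F ∪ (Z ∩ core)) ∪ C
      F∪Z⊆ {x} x∈ with x∈p∪q⁻ F Z x∈ | x ∈? core
      ... | inj₁ x∈F | _          = p⊆p∪q C (p⊆p∪q (Z ∩ core) x∈F)
      ... | inj₂ x∈Z | yes x∈core = p⊆p∪q C (q⊆p∪q F (Z ∩ core) (x∈p∩q⁺ (x∈Z , x∈core)))
      ... | inj₂ x∈Z | no  x∉core = q⊆p∪q _ C (subst (_ ∈_) Z─core≡C (x∈p∧x∉q⇒x∈p─q x∈Z x∉core))
      spans : Spans F core (Z ∩ core)
      spans = ≤-antisym (r-mono (∪-least F⊆core (p∩q⊆q Z core))) (+-cancelʳ-≤ ∣ C ∣ _ _ (begin
        r core + ∣ C ∣             ≡⟨ rK ⟨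
        r K                        ≡⟨ cl-rank (F ∪ Z) ⟩
        r (F ∪ Z)                  ≤⟨ r-⊆∪-≤ (F ∪ (Z ∩ core)) C F∪Z⊆ ⟩
        r (F ∪ (Z ∩ core)) + ∣ C ∣ ∎))
      free-flat : IsFlat M (core ∪ (Z ─ core))
      free-flat = subst (IsFlat M) (sym (trans (cong (core ∪_) Z─core≡C) core∪C≡K)) (cl-flat (F ∪ Z))
      free-rank : r (core ∪ (Z ─ core)) ≡ r core + ∣ Z ─ core ∣
      free-rank = subst (λ D → r (core ∪ D) ≡ r core + ∣ D ∣) (sym Z─core≡C) (trans (cong r core∪C≡K) rK)

    K≡ : ∀ {H} → IsCore F G Z H → K ≡ H ∪ (Z ─ H)
    K≡ {H} (((_ , _) , F⊆H , _) , spans , free-flat , _) = ⊆-antisym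
      (λ e∈K → flat-spanned-∈ F∪Z⊆ free-flat (∈-cl⁻ e∈K))
      (λ e∈ → ∈-cl⁺ (≤-antisym (≤-trans (r-mono (∪-least F∪Z⊆ (⁅x⁆⊆ e∈)))
                                         (≤-reflexive (sym rF∪Z)))
                               (r-mono (p⊆p∪q ⁅ _ ⁆))))
      where
      F∪Z⊆ : F ∪ Z ⊆ H ∪ (Z ─ H)
      F∪Z⊆ = ∪-least (p⊆p∪q (Z ─ H) ∘ F⊆H) (∈-∪-─ H Z)
      rF∪Z : r (F ∪ Z) ≡ r (H ∪ (Z ─ H))
      rF∪Z = ≤-antisym (r-mono F∪Z⊆) (begin
        r (H ∪ (Z ─ H))              ≡⟨ r-∪-cong (Z ─ H) (∪-least F⊆H (p∩q⊆q Z H)) spans ⟨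
        r ((F ∪ (Z ∩ H)) ∪ (Z ─ H))  ≤⟨ r-mono (∪-least (∪-least (p⊆p∪q Z) (q⊆p∪q F Z ∘ p∩q⊆p Z H))
                                                         (q⊆p∪q F Z ∘ p─q⊆p Z H)) ⟩
        r (F ∪ Z)                    ∎)
        where open ≤-Reasoning

    core-unique : ∀ H → IsCore F G Z H → H ≡ core
    core-unique H isCore@(((_ , H-cyclic) , _) , _ , _ , free-rank) = ⊆-antisym H⊆core core⊆H
      where
      open ≤-Reasoning
      J : Subset n
      J = Z ─ H
      H⊆core : H ⊆ core
      H⊆core {e} e∈H = x∈p∧x∉q⇒x∈p─q (subst (e ∈_) (sym (K≡ isCore)) (p⊆p∪q J e∈H)) λ e∈C →
        <⇒≱ (proj₂ (∈-coloops⁻ e∈C)) (begin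
          r K               ≡⟨ cong r (K≡ isCore) ⟩
          r (H ∪ J)         ≡⟨ r-∪-cong J (p─q⊆p H ⁅ e ⁆) (H-cyclic e e∈H) ⟨
          r ((H - e) ∪ J)   ≤⟨ r-mono (subst (λ K′ → (H - e) ∪ J ⊆ K′ - e) (sym (K≡ isCore)) H-e∪J⊆) ⟩
          r (K - e)         ∎)
        where
        H-e∪J⊆ : (H - e) ∪ J ⊆ (H ∪ J) - e
        H-e∪J⊆ {x} x∈ with x∈p∪q⁻ (H - e) J x∈
        ... | inj₁ x∈H-e = x∈p∧x≢y⇒x∈p-y (p⊆p∪q J (p─q⊆p H ⁅ e ⁆ x∈H-e)) (x∈p-y⇒x≢y H x∈H-e)
        ... | inj₂ x∈J   = x∈p∧x≢y⇒x∈p-y (q⊆p∪q H J x∈J) λ { refl → x∈p─q⇒x∉q Z H x∈J e∈H }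
      core⊆H : core ⊆ H
      core⊆H {e} e∈core with x∈p∪q⁻ H J (subst (e ∈_) (K≡ isCore) (core⊆K e∈core))
      ... | inj₁ e∈H = e∈H
      ... | inj₂ e∈J = ⊥-elim (<⇒≱ (begin-strict
          r (K - e)         ≤⟨ r-⊆∪-≤ H (J - e) K-e⊆ ⟩
          r H + ∣ J - e ∣   <⟨ +-monoʳ-< (r H) (≤-reflexive (suc∣p-x∣ J e∈J)) ⟩
          r H + ∣ J ∣       ≡⟨ free-rank ⟨
          r (H ∪ J)         ≡⟨ cong r (K≡ isCore) ⟨
          r K               ∎) (not-coloop e∈core))
        where
        K-e⊆ : K - e ⊆ H ∪ (J - e)
        K-e⊆ {x} x∈ with x∈p∪q⁻ H J (subst (x ∈_) (K≡ isCore) (p─q⊆p K ⁅ e ⁆ x∈))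
        ... | inj₁ x∈H = p⊆p∪q (J - e) x∈H
        ... | inj₂ x∈J = q⊆p∪q H (J - e) (x∈p∧x≢y⇒x∈p-y x∈J (x∈p-y⇒x≢y K x∈))

  𝟙-isCore-∪ : ∀ {F G H Y J} → Between F G H → Y ⊆ H ─ F → J ⊆ G ─ H →
               𝟙 (isCore? F G (Y ∪ J) H) ≡ 𝟙 (spans? F H Y) * 𝟙 (freeOver? H J)
  𝟙-isCore-∪ {F} {G} {H} {Y} {J} between Y⊆ J⊆ =
    trans (𝟙-cong (isCore? F G (Y ∪ J) H) (spans? F H Y ×-dec freeOver? H J)
                  (λ (_ , spans , free) → subst (Spans F H) Y∩ spans , subst (FreeOver H) J─ free)
                  (λ (spans , free) → between , subst (Spans F H) (sym Y∩) spans , subst (FreeOver H) (sym J─) free))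
          (𝟙-× (spans? F H Y) (freeOver? H J))
    where
    Y⊆H : Y ⊆ H
    Y⊆H = p─q⊆p H F ∘ Y⊆
    J∉H : ∀ {x} → x ∈ J → x ∉ H
    J∉H = x∈p─q⇒x∉q G H ∘ J⊆
    Y∩ : (Y ∪ J) ∩ H ≡ Y
    Y∩ = ∪-∩-cancel Y⊆H J∉H
    J─ : (Y ∪ J) ─ H ≡ J
    J─ = ∪-─-cancel Y⊆H J∉H

  spanning : Subset n → Subset n → ℕ → ℕ
  spanning F H = sizes (H ─ F) (𝟙 ∘ spans? F H)

  free : Subset n → Subset n → ℕ → ℕ
  free H G = sizes (G ─ H) (𝟙 ∘ freeOver? H)

  coreSum : Subset n → Subset n → Subset n → (Subset n → ℕ) → ℕ
  coreSum F G H g = ∑[ Y ⊆ H ─ F ] 𝟙 (spans? F H Y) * (∑[ J ⊆ G ─ H ] 𝟙 (freeOver? H J) * g (Y ∪ J))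

  module _ (F G : Subset n) (F-cyclic : IsCyclic M F) (G-flat : IsFlat M G) (F⊆G : F ⊆ G) where

    ∑-with-core : ∀ H (g : Subset n → ℕ) (between? : Dec (Between F G H)) →
      ∑[ Z ⊆ G ─ F ] 𝟙 (isCore? F G Z H) * g Z ≡
      𝟙 between? * coreSum F G H g
    ∑-with-core H g (no ¬between) =
      ∑⊆-zero (G ─ F) λ Z _ → 𝟙*-zero (isCore? F G Z H) λ isCore → ⊥-elim (¬between (proj₁ isCore))
    ∑-with-core H g (yes between@(_ , F⊆H , H⊆G)) =
      begin
        ∑[ Z ⊆ G ─ F ] 𝟙 (isCore? F G Z H) * g Z
      ≡⟨ cong (λ U → ∑[ Z ⊆ U ] 𝟙 (isCore? F G Z H) * g Z) (─-split F⊆H H⊆G) ⟩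
        ∑[ Z ⊆ (H ─ F) ∪ (G ─ H) ] 𝟙 (isCore? F G Z H) * g Z
      ≡⟨ ∑⊆-∪ (H ─ F) (G ─ H) _ (─-disjoint F H G) ⟩
        ∑[ Y ⊆ H ─ F ] ∑[ J ⊆ G ─ H ] 𝟙 (isCore? F G (Y ∪ J) H) * g (Y ∪ J)
      ≡⟨ ∑⊆-cong (H ─ F) (λ Y Y⊆ → trans (∑⊆-cong (G ─ H) λ J J⊆ →
                   trans (cong (_* g (Y ∪ J)) (𝟙-isCore-∪ between Y⊆ J⊆)) (*-assoc (𝟙 (spans? F H Y)) _ _))
                                       (sym (*-distribˡ-∑⊆ (G ─ H) (𝟙 (spans? F H Y)) _))) ⟩
        coreSum F G H g
      ≡⟨ +-identityʳ _ ⟨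
        1 * coreSum F G H g
      ∎
      where open ≡-Reasoning

    ∑-by-core : ∀ (g : Subset n → ℕ) →
      ∑⊆ (G ─ F) g ≡
      ∑[ H ⊆ ⊤ ] 𝟙 (between? F G H) * coreSum F G H g
    ∑-by-core g =
      begin
        ∑⊆ (G ─ F) g
      ≡⟨ ∑⊆-cong (G ─ F) (λ Z Z⊆ → sym (unique-core Z (p─q⊆p G F ∘ Z⊆))) ⟩
        ∑[ Z ⊆ G ─ F ] ∑[ H ⊆ ⊤ ] 𝟙 (isCore? F G Z H) * g Z
      ≡⟨ ∑⊆-comm (G ─ F) ⊤ (λ Z H → 𝟙 (isCore? F G Z H) * g Z) ⟩
        ∑[ H ⊆ ⊤ ] ∑[ Z ⊆ G ─ F ] 𝟙 (isCore? F G Z H) * g Z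
      ≡⟨ ∑⊆-cong ⊤ (λ H _ → ∑-with-core H g (between? F G H)) ⟩
        ∑[ H ⊆ ⊤ ] 𝟙 (between? F G H) * coreSum F G H g
      ∎
      where
      open ≡-Reasoning
      unique-core : ∀ Z → Z ⊆ G → ∑[ H ⊆ ⊤ ] 𝟙 (isCore? F G Z H) * g Z ≡ g Z
      unique-core Z Z⊆G =
        ∑⊆-δ ⊤ (isCore? F G Z) (λ _ → g Z) core (⊆-max core) core-isCore λ H _ → core-unique H
        where open Core F G Z F-cyclic G-flat F⊆G Z⊆G

    choose-by-core : ∀ s →
      ∣ G ─ F ∣ choose s ≡ ∑[ H ⊆ ⊤ ] 𝟙 (between? F G H) * (spanning F H ⋆ free H G) s
    choose-by-core s =
      begin
        ∣ G ─ F ∣ choose s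
      ≡⟨ ∑⊆-size (G ─ F) s ⟨
        ∑[ Z ⊆ G ─ F ] δ ∣ Z ∣ s
      ≡⟨ ∑-by-core (λ Z → δ ∣ Z ∣ s) ⟩
        ∑[ H ⊆ ⊤ ] 𝟙 (between? F G H) * coreSum F G H (λ Z → δ ∣ Z ∣ s)
      ≡⟨ ∑⊆-cong ⊤ (λ H _ → 𝟙*-cong (between? F G H) λ (_ , F⊆H , H⊆G) →
           trans (∑⊆-cong (H ─ F) λ Y Y⊆ → cong (𝟙 (spans? F H Y) *_) (∑⊆-cong (G ─ H) λ J J⊆ →
                    cong (λ m → 𝟙 (freeOver? H J) * δ m s) (∣p∪q∣-disjoint Y J (disjoint-parts Y⊆ J⊆))))
                 (sizes-⋆ (H ─ F) (G ─ H) (𝟙 ∘ spans? F H) (𝟙 ∘ freeOver? H) s)) ⟩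
        ∑[ H ⊆ ⊤ ] 𝟙 (between? F G H) * (spanning F H ⋆ free H G) s
      ∎
      where
      open ≡-Reasoning
      disjoint-parts : ∀ {H Y J} → Y ⊆ H ─ F → J ⊆ G ─ H → Y ∩ J ≡ ⊥
      disjoint-parts {H} {Y} {J} Y⊆ J⊆ =
        disjoint Y J λ x∈Y x∈J → x∈p─q⇒x∉q G H (J⊆ x∈J) (p─q⊆p H F (Y⊆ x∈Y))

  spans-≥ : ∀ {F H Y} → Spans F H Y → r H ∸ r F ≤ ∣ Y ∣
  spans-≥ {F} {H} {Y} spans = begin
    r H ∸ r F           ≡⟨ cong (_∸ r F) spans ⟨
    r (F ∪ Y) ∸ r F     ≤⟨ ∸-monoˡ-≤ (r F) (r-⊆∪-≤ F Y ⊆-refl) ⟩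
    r F + ∣ Y ∣ ∸ r F   ≡⟨ m+n∸m≡n (r F) ∣ Y ∣ ⟩
    ∣ Y ∣               ∎
    where open ≤-Reasoning

  freeOver-< : ∀ {F G J} → IsCyclic M G → F ⊆ G → F ≢ G → J ⊆ G ─ F → FreeOver F J →
               ∣ J ∣ < r G ∸ r F
  freeOver-< {F} {G} {J} G-cyclic F⊆G F≢G J⊆ (F∪J-flat , rF∪J) = ≰⇒> λ gap≤∣J∣ →
    let rF∪J≡rG = rF∪J≡rG gap≤∣J∣
    in  J-nonempty (nonempty? J) (flat-maximal F∪J-flat F∪J⊆G rF∪J≡rG) rF∪J≡rG
    where
    open ≤-Reasoning
    F∪J⊆G : F ∪ J ⊆ G
    F∪J⊆G = ∪-least F⊆G (p─q⊆p G F ∘ J⊆)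
    rF∪J≡rG : r G ∸ r F ≤ ∣ J ∣ → r (F ∪ J) ≡ r G
    rF∪J≡rG gap≤∣J∣ = ≤-antisym (r-mono F∪J⊆G) (begin
      r G                 ≡⟨ m+[n∸m]≡n (r-mono F⊆G) ⟨
      r F + (r G ∸ r F)   ≤⟨ +-monoʳ-≤ (r F) gap≤∣J∣ ⟩
      r F + ∣ J ∣         ≡⟨ rF∪J ⟨
      r (F ∪ J)           ∎)
    J-nonempty : Dec (Nonempty J) → G ⊆ F ∪ J → ¬ r (F ∪ J) ≡ r G
    J-nonempty (no J-empty) G⊆ _ =
      F≢G (⊆-antisym F⊆G (subst (G ⊆_) (trans (cong (F ∪_) (Empty-unique J-empty)) (∪-identityʳ F)) G⊆))
    J-nonempty (yes (e , e∈J)) G⊆ rF∪J≡rG = <-irrefl (G-cyclic e (p─q⊆p G F (J⊆ e∈J))) (begin-strict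
      r (G - e)         ≤⟨ r-⊆∪-≤ F (J - e) G-e⊆ ⟩
      r F + ∣ J - e ∣   <⟨ +-monoʳ-< (r F) (≤-reflexive (suc∣p-x∣ J e∈J)) ⟩
      r F + ∣ J ∣       ≡⟨ rF∪J ⟨
      r (F ∪ J)         ≡⟨ rF∪J≡rG ⟩
      r G               ∎)
      where
      G-e⊆ : G - e ⊆ F ∪ (J - e)
      G-e⊆ {x} x∈ with x∈p∪q⁻ F J (G⊆ (p─q⊆p G ⁅ e ⁆ x∈))
      ... | inj₁ x∈F = p⊆p∪q (J - e) x∈F
      ... | inj₂ x∈J = q⊆p∪q F (J - e) (x∈p∧x≢y⇒x∈p-y x∈J (x∈p-y⇒x≢y G x∈))

  spanning-below : ∀ F H s → s < r H ∸ r F → spanning F H s ≡ 0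
  spanning-below F H s s<gap = ∑⊆-zero (H ─ F) λ Y _ → 𝟙*-zero (spans? F H Y) λ spans →
    𝟙-no (∣ Y ∣ ≟ s) λ { refl → <⇒≱ s<gap (spans-≥ spans) }

  free-beyond : ∀ F G t → IsCyclic M G → F ⊆ G → F ≢ G → r G ∸ r F ≤ t → free F G t ≡ 0
  free-beyond F G t G-cyclic F⊆G F≢G gap≤t = ∑⊆-zero (G ─ F) λ J J⊆ → 𝟙*-zero (freeOver? F J) λ freeOver →
    𝟙-no (∣ J ∣ ≟ t) λ { refl → <⇒≱ (freeOver-< G-cyclic F⊆G F≢G J⊆ freeOver) gap≤t }

  spanning-self : ∀ G s → spanning G G s ≡ δ 0 s
  spanning-self G s =
    trans (sizes-⊥ (G ─ G) (𝟙 ∘ spans? G G) s (p─p≡⊥ G))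
          (trans (cong (_* δ 0 s) (𝟙-yes (spans? G G ⊥) (cong r (∪-identityʳ G)))) (*-identityˡ (δ 0 s)))

  free-self : ∀ G s → IsFlat M G → free G G s ≡ δ 0 s
  free-self G s G-flat =
    trans (sizes-⊥ (G ─ G) (𝟙 ∘ freeOver? G) s (p─p≡⊥ G))
          (trans (cong (_* δ 0 s) (𝟙-yes (freeOver? G ⊥) G-free-over-⊥)) (*-identityˡ (δ 0 s)))
    where
    G-free-over-⊥ : FreeOver G ⊥
    G-free-over-⊥ = subst (IsFlat M) (sym (∪-identityʳ G)) G-flat ,
                    trans (cong r (∪-identityʳ G)) (sym (trans (cong (r G +_) (∣⊥∣≡0 n)) (+-identityʳ (r G))))

module BlockSums {n k} (M : Matroid n) (P : Condensation M k)
                 (R : Fin k → Subset n) (rep : IsRepSystem P R) where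

  open Flats M
  open Decomposition M

  InBlockBelow : Fin k → Subset n → Subset n → Set
  InBlockBelow i G F = IsCyclicFlat M F × blk P F ≡ i × F ⊆ G

  inBlockBelow? : ∀ i G F → Dec (InBlockBelow i G F)
  inBlockBelow? i G F = isCyclicFlat? M F ×-dec ((blk P F Fin.≟ i) ×-dec (F ⊆? G))

  CyclicFlatBelow : Subset n → Subset n → Set
  CyclicFlatBelow G H = IsCyclicFlat M H × H ⊆ G

  cyclicFlatBelow? : ∀ G H → Dec (CyclicFlatBelow G H)
  cyclicFlatBelow? G H = isCyclicFlat? M H ×-dec (H ⊆? G)

  σ : Fin k → Subset n → ℕ → ℕ
  σ i G s = ∑[ F ⊆ ⊤ ] 𝟙 (inBlockBelow? i G F) * spanning F G s

  ι : Fin k → Subset n → ℕ → ℕ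
  ι i G s = ∑[ F ⊆ ⊤ ] 𝟙 (inBlockBelow? i G F) * free F G s

  term : Fin k → Subset n → Fin k → ℕ → ℕ
  term i G j s = ∑[ H ⊆ ⊤ ] 𝟙 (inBlockBelow? j G H) * (σ i H ⋆ free H G) s

  same-block : ∀ {F G} → IsCyclicFlat M F → IsCyclicFlat M G → blk P F ≡ blk P G →
               ∣ F ∣ ≡ ∣ G ∣ × r F ≡ r G
  same-block {F} {G} F-cf G-cf same = blk-card P F G F-cf G-cf same , blk-rank P F G F-cf G-cf same

  ∣∣-block : ∀ {F i} → IsCyclicFlat M F → blk P F ≡ i → ∣ F ∣ ≡ ∣ R i ∣
  ∣∣-block {F} {i} F-cf F∈i = proj₁ (same-block F-cf (proj₁ (rep i)) (trans F∈i (sym (proj₂ (rep i)))))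

  r-block : ∀ {F i} → IsCyclicFlat M F → blk P F ≡ i → r F ≡ r (R i)
  r-block {F} {i} F-cf F∈i = proj₂ (same-block F-cf (proj₁ (rep i)) (trans F∈i (sym (proj₂ (rep i)))))

  block-⊆-≡ : ∀ {F H j} → IsCyclicFlat M F → blk P F ≡ j → IsCyclicFlat M H → blk P H ≡ j →
              F ⊆ H → F ≡ H
  block-⊆-≡ F-cf F∈j H-cf H∈j F⊆H =
    ⊆-∣∣-≡ F⊆H (≤-reflexive (trans (∣∣-block H-cf H∈j) (sym (∣∣-block F-cf F∈j))))

  ∑-blocks : ∀ G (f : Subset n → ℕ) →
             ∑[ H ⊆ ⊤ ] 𝟙 (cyclicFlatBelow? G H) * f H ≡
             sum (λ j → ∑[ H ⊆ ⊤ ] 𝟙 (inBlockBelow? j G H) * f H)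
  ∑-blocks G f =
    trans (∑⊆-cong ⊤ λ H _ → trans (cong (_* f H) (sym (one-block H (cyclicFlatBelow? G H))))
                                  (*-distribʳ-sum (f H) (λ j → 𝟙 (inBlockBelow? j G H))))
          (∑⊆-sum-comm ⊤ λ H j → 𝟙 (inBlockBelow? j G H) * f H)
    where
    one-block : ∀ H (below? : Dec (CyclicFlatBelow G H)) → sum (λ j → 𝟙 (inBlockBelow? j G H)) ≡ 𝟙 below?
    one-block H (yes (H-cf , H⊆G)) =
      trans (sum-cong-≗ λ j → sym (*-identityʳ (𝟙 (inBlockBelow? j G H))))
            (sum-δ (λ j → inBlockBelow? j G H) (λ _ → 1) (blk P H) (H-cf , refl , H⊆G)
                   λ j (_ , H∈j , _) → sym H∈j)
    one-block H (no ¬below) =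
      sum-zero λ j → 𝟙-no (inBlockBelow? j G H) λ (H-cf , _ , H⊆G) → ¬below (H-cf , H⊆G)

  𝟙-swap : ∀ i G F H → 𝟙 (inBlockBelow? i G F) * 𝟙 (between? F G H) ≡
                       𝟙 (cyclicFlatBelow? G H) * 𝟙 (inBlockBelow? i H F)
  𝟙-swap i G F H =
    begin
      𝟙 (inBlockBelow? i G F) * 𝟙 (between? F G H)
    ≡⟨ 𝟙-× (inBlockBelow? i G F) (between? F G H) ⟨
      𝟙 (inBlockBelow? i G F ×-dec between? F G H)
    ≡⟨ 𝟙-cong (inBlockBelow? i G F ×-dec between? F G H) (cyclicFlatBelow? G H ×-dec inBlockBelow? i H F)
              (λ ((F-cf , F∈i , _) , (H-cf , F⊆H , H⊆G)) → (H-cf , H⊆G) , (F-cf , F∈i , F⊆H))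
              (λ ((H-cf , H⊆G) , (F-cf , F∈i , F⊆H)) →
                 (F-cf , F∈i , ⊆-trans F⊆H H⊆G) , (H-cf , F⊆H , H⊆G)) ⟩
      𝟙 (cyclicFlatBelow? G H ×-dec inBlockBelow? i H F)
    ≡⟨ 𝟙-× (cyclicFlatBelow? G H) (inBlockBelow? i H F) ⟩
      𝟙 (cyclicFlatBelow? G H) * 𝟙 (inBlockBelow? i H F)
    ∎
    where open ≡-Reasoning

  choose-in-block : ∀ i G F s → IsFlat M G → InBlockBelow i G F →
    (∣ G ∣ ∸ ∣ R i ∣) choose s ≡ ∑[ H ⊆ ⊤ ] 𝟙 (between? F G H) * (spanning F H ⋆ free H G) s
  choose-in-block i G F s G-flat (F-cf@(_ , F-cyclic) , F∈i , F⊆G) =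
    begin
      (∣ G ∣ ∸ ∣ R i ∣) choose s
    ≡⟨ cong (λ m → (∣ G ∣ ∸ m) choose s) (∣∣-block F-cf F∈i) ⟨
      (∣ G ∣ ∸ ∣ F ∣) choose s
    ≡⟨ cong (λ m → (m ∸ ∣ F ∣) choose s) (∣q─p∣+∣p∣ F⊆G) ⟨
      (∣ G ─ F ∣ + ∣ F ∣ ∸ ∣ F ∣) choose s
    ≡⟨ cong (_choose s) (m+n∸n≡m ∣ G ─ F ∣ ∣ F ∣) ⟩
      ∣ G ─ F ∣ choose s
    ≡⟨ choose-by-core F G F-cyclic G-flat F⊆G s ⟩
      ∑[ H ⊆ ⊤ ] 𝟙 (between? F G H) * (spanning F H ⋆ free H G) s
    ∎
    where open ≡-Reasoning

  Acount≡∑ : ∀ i G → Acount M (blk P) i G ≡ ∑[ F ⊆ ⊤ ] 𝟙 (inBlockBelow? i G F)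
  Acount≡∑ i G = count≡∑⊆ (inBlockBelow? i G)

  Acount-choose : ∀ i G s → IsFlat M G →
    Acount M (blk P) i G * ((∣ G ∣ ∸ ∣ R i ∣) choose s) ≡ sum (λ j → term i G j s)
  Acount-choose i G s G-flat =
    begin
      Acount M (blk P) i G * c
    ≡⟨ trans (cong (_* c) (Acount≡∑ i G)) (*-distribʳ-∑⊆ ⊤ c (𝟙 ∘ inBlockBelow? i G)) ⟩
      ∑[ F ⊆ ⊤ ] 𝟙 (inBlockBelow? i G F) * c
    ≡⟨ ∑⊆-cong ⊤ (λ F _ → 𝟙*-cong (inBlockBelow? i G F) (choose-in-block i G F s G-flat)) ⟩
      ∑[ F ⊆ ⊤ ] 𝟙 (inBlockBelow? i G F) * (∑[ H ⊆ ⊤ ] 𝟙 (between? F G H) * X F H)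
    ≡⟨ ∑⊆-cong ⊤ (λ F _ → trans (*-distribˡ-∑⊆ ⊤ (𝟙 (inBlockBelow? i G F))
                                                λ H → 𝟙 (between? F G H) * X F H)
                               (∑⊆-cong ⊤ λ H _ → regroup F H)) ⟩
      ∑[ F ⊆ ⊤ ] ∑[ H ⊆ ⊤ ] 𝟙 (cyclicFlatBelow? G H) * (𝟙 (inBlockBelow? i H F) * X F H)
    ≡⟨ ∑⊆-comm ⊤ ⊤ (λ F H → 𝟙 (cyclicFlatBelow? G H) * (𝟙 (inBlockBelow? i H F) * X F H)) ⟩
      ∑[ H ⊆ ⊤ ] ∑[ F ⊆ ⊤ ] 𝟙 (cyclicFlatBelow? G H) * (𝟙 (inBlockBelow? i H F) * X F H)
    ≡⟨ ∑⊆-cong ⊤ (λ H _ → trans (sym (*-distribˡ-∑⊆ ⊤ (𝟙 (cyclicFlatBelow? G H))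
                                                    λ F → 𝟙 (inBlockBelow? i H F) * X F H))
                               (cong (𝟙 (cyclicFlatBelow? G H) *_)
                                     (∑⊆-⋆ ⊤ (𝟙 ∘ inBlockBelow? i H) (λ F → spanning F H) (free H G) s))) ⟩
      ∑[ H ⊆ ⊤ ] 𝟙 (cyclicFlatBelow? G H) * (σ i H ⋆ free H G) s
    ≡⟨ ∑-blocks G (λ H → (σ i H ⋆ free H G) s) ⟩
      sum (λ j → term i G j s)
    ∎
    where
    open ≡-Reasoning
    c : ℕ
    c = (∣ G ∣ ∸ ∣ R i ∣) choose s
    X : Subset n → Subset n → ℕ
    X F H = (spanning F H ⋆ free H G) s
    regroup : ∀ F H → 𝟙 (inBlockBelow? i G F) * (𝟙 (between? F G H) * X F H) ≡
                      𝟙 (cyclicFlatBelow? G H) * (𝟙 (inBlockBelow? i H F) * X F H)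
    regroup F H = trans (sym (*-assoc (𝟙 (inBlockBelow? i G F)) (𝟙 (between? F G H)) (X F H)))
                        (trans (cong (_* X F H) (𝟙-swap i G F H))
                               (*-assoc (𝟙 (cyclicFlatBelow? G H)) (𝟙 (inBlockBelow? i H F)) (X F H)))

  ∑-block-self : ∀ i G (f : Subset n → ℕ) → IsCyclicFlat M G → blk P G ≡ i →
                 ∑[ F ⊆ ⊤ ] 𝟙 (inBlockBelow? i G F) * f F ≡ f G
  ∑-block-self i G f G-cf G∈i = ∑⊆-δ ⊤ (inBlockBelow? i G) f G (⊆-max G) (G-cf , G∈i , ⊆-refl)
    λ F _ (F-cf , F∈i , F⊆G) → block-⊆-≡ F-cf F∈i G-cf G∈i F⊆G

  σ-self : ∀ i G s → IsCyclicFlat M G → blk P G ≡ i → σ i G s ≡ δ 0 s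
  σ-self i G s G-cf G∈i = trans (∑-block-self i G (λ F → spanning F G s) G-cf G∈i) (spanning-self G s)

  ι-self : ∀ i G s → IsCyclicFlat M G → blk P G ≡ i → ι i G s ≡ δ 0 s
  ι-self i G s G-cf G∈i = trans (∑-block-self i G (λ F → free F G s) G-cf G∈i) (free-self G s (proj₁ G-cf))

  σ-below : ∀ i G s → s < r G ∸ r (R i) → σ i G s ≡ 0
  σ-below i G s s<gap = ∑⊆-zero ⊤ λ F _ → 𝟙*-zero (inBlockBelow? i G F) λ (F-cf , F∈i , _) →
    spanning-below F G s (subst (λ m → s < r G ∸ m) (sym (r-block F-cf F∈i)) s<gap)

  ι-beyond : ∀ i G s → IsCyclicFlat M G → i ≢ blk P G → r G ∸ r (R i) ≤ s → ι i G s ≡ 0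
  ι-beyond i G s (_ , G-cyclic) i≢G gap≤s =
    ∑⊆-zero ⊤ λ F _ → 𝟙*-zero (inBlockBelow? i G F) λ (F-cf , F∈i , F⊆G) →
      free-beyond F G s G-cyclic F⊆G (λ { refl → i≢G (sym F∈i) })
                  (subst (λ m → r G ∸ m ≤ s) (sym (r-block F-cf F∈i)) gap≤s)

  term-small : ∀ i G j s → j ≢ i → ∣ R j ∣ ≤ ∣ R i ∣ → term i G j s ≡ 0
  term-small i G j s j≢i ∣Rj∣≤∣Ri∣ =
    ∑⊆-zero ⊤ λ H _ → 𝟙*-zero (inBlockBelow? j G H) λ (H-cf , H∈j , _) →
      ⋆-zeroˡ (σ i H) (free H G) s (σ-vanishes H H-cf H∈j)
    where
    σ-vanishes : ∀ H → IsCyclicFlat M H → blk P H ≡ j → ∀ t → σ i H t ≡ 0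
    σ-vanishes H H-cf H∈j t = ∑⊆-zero ⊤ λ F _ → 𝟙*-zero (inBlockBelow? i H F) λ (F-cf , F∈i , F⊆H) →
      ⊥-elim (j≢i (trans (sym H∈j) (trans (cong (blk P) (sym (⊆-∣∣-≡ F⊆H (begin
        ∣ H ∣     ≡⟨ ∣∣-block H-cf H∈j ⟩
        ∣ R j ∣   ≤⟨ ∣Rj∣≤∣Ri∣ ⟩
        ∣ R i ∣   ≡⟨ ∣∣-block F-cf F∈i ⟨
        ∣ F ∣     ∎)))) F∈i)))
      where open ≤-Reasoning

  term-large : ∀ i G j s → IsCyclicFlat M G → j ≢ blk P G → ∣ G ∣ ≤ ∣ R j ∣ → term i G j s ≡ 0
  term-large i G j s G-cf j≢G ∣G∣≤∣Rj∣ =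
    ∑⊆-zero ⊤ λ H _ → 𝟙*-zero (inBlockBelow? j G H) λ (H-cf , H∈j , H⊆G) →
      ⊥-elim (j≢G (trans (sym H∈j) (cong (blk P)
        (⊆-∣∣-≡ H⊆G (≤-trans ∣G∣≤∣Rj∣ (≤-reflexive (sym (∣∣-block H-cf H∈j))))))))

  term-factor : ∀ i G j s (c : ℕ → ℕ) → (∀ H → InBlockBelow j G H → ∀ t → σ i H t ≡ c t) →
                term i G j s ≡ (c ⋆ ι j G) s
  term-factor i G j s c σ≡c =
    trans (∑⊆-cong ⊤ λ H _ → 𝟙*-cong (inBlockBelow? j G H) λ H-below →
             ∑≤-cong s λ t _ → cong (_* free H G (s ∸ t)) (σ≡c H H-below t))
          (∑⊆-⋆ʳ ⊤ (𝟙 ∘ inBlockBelow? j G) c (λ H → free H G) s)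

  term-self-i : ∀ i G s → term i G i s ≡ ι i G s
  term-self-i i G s =
    trans (term-factor i G i s (δ 0) λ H (H-cf , H∈i , _) t → σ-self i H t H-cf H∈i) (δ0-⋆ (ι i G) s)

  term-self-G : ∀ i G s → IsCyclicFlat M G → term i G (blk P G) s ≡ σ i G s
  term-self-G i G s G-cf =
    begin
      term i G (blk P G) s
    ≡⟨ ∑-block-self (blk P G) G (λ H → (σ i H ⋆ free H G) s) G-cf refl ⟩
      (σ i G ⋆ free G G) s
    ≡⟨ ∑≤-cong s (λ t _ → cong (σ i G t *_) (free-self G (s ∸ t) (proj₁ G-cf))) ⟩
      (σ i G ⋆ δ 0) s
    ≡⟨ ⋆-δ0 (σ i G) s ⟩
      σ i G s
    ∎
    where open ≡-Reasoning

  rest : Fin k → Subset n → ℕ → ℕ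
  rest i G s = sum λ j → 𝟙 (Distinct₂? (blk P G) i j) * term i G j s

  Acount-choose-split : ∀ i G s → IsCyclicFlat M G → i ≢ blk P G →
    Acount M (blk P) i G * ((∣ G ∣ ∸ ∣ R i ∣) choose s) ≡ σ i G s + (ι i G s + rest i G s)
  Acount-choose-split i G s G-cf i≢G =
    trans (Acount-choose i G s (proj₁ G-cf))
          (trans (sum-extract₂ (λ j → term i G j s) (blk P G) i (i≢G ∘ sym))
                 (cong₂ _+_ (term-self-G i G s G-cf) (cong (_+ rest i G s) (term-self-i i G s))))

+-cancel-vanishing : ∀ {x y x′ y′ z} → x + (y + z) ≡ x′ + (y′ + z) →
                     (x ≡ 0 × x′ ≡ 0) ⊎ (y ≡ 0 × y′ ≡ 0) → x ≡ x′ × y ≡ y′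
+-cancel-vanishing {z = z} eq (inj₁ (refl , refl)) = refl , +-cancelʳ-≡ z _ _ eq
+-cancel-vanishing {x} {x′ = x′} {z = z} eq (inj₂ (refl , refl)) = +-cancelʳ-≡ z x x′ eq , refl

module Transfer {n n′ k k′} (M : Matroid n) (M′ : Matroid n′)
  (P : Condensation M k) (R : Fin k → Subset n) (rep : IsRepSystem P R)
  (P′ : Condensation M′ k′) (R′ : Fin k′ → Subset n′) (rep′ : IsRepSystem P′ R′)
  (φ : Fin k ⤖ Fin k′)
  (A≡ : ∀ i j → A P′ R′ (Bijection.to φ i) (Bijection.to φ j) ≡ A P R i j)
  (∣R∣≡ : ∀ i → ∣ R′ (Bijection.to φ i) ∣ ≡ ∣ R i ∣)
  (rR≡ : ∀ i → rank M′ (R′ (Bijection.to φ i)) ≡ rank M (R i)) where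

  open BlockSums M P R rep
  module ′ = BlockSums M′ P′ R′ rep′

  φ⁺ : Fin k → Fin k′
  φ⁺ = Bijection.to φ

  φ⁺-injective : ∀ {i j} → φ⁺ i ≡ φ⁺ j → i ≡ j
  φ⁺-injective = Bijection.injective φ

  Corresponding : Subset n → Subset n′ → Set
  Corresponding G G′ = IsCyclicFlat M G × IsCyclicFlat M′ G′ × blk P′ G′ ≡ φ⁺ (blk P G)

  rep-corresponding : ∀ j → Corresponding (R j) (R′ (φ⁺ j))
  rep-corresponding j =
    proj₁ (rep j) , proj₁ (rep′ (φ⁺ j)) , trans (proj₂ (rep′ (φ⁺ j))) (cong φ⁺ (sym (proj₂ (rep j))))

  corresponding-∣∣ : ∀ {G G′} → Corresponding G G′ → ∣ G′ ∣ ≡ ∣ G ∣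
  corresponding-∣∣ {G} (G-cf , G′-cf , G′∈) =
    trans (′.∣∣-block G′-cf G′∈) (trans (∣R∣≡ (blk P G)) (sym (∣∣-block G-cf refl)))

  corresponding-r : ∀ {G G′} → Corresponding G G′ → rank M′ G′ ≡ rank M G
  corresponding-r {G} (G-cf , G′-cf , G′∈) =
    trans (′.r-block G′-cf G′∈) (trans (rR≡ (blk P G)) (sym (r-block G-cf refl)))

  corresponding-Acount : ∀ i {G G′} → Corresponding G G′ →
                         Acount M′ (blk P′) (φ⁺ i) G′ ≡ Acount M (blk P) i G
  corresponding-Acount i {G} {G′} (G-cf , G′-cf , G′∈) =
    trans (blk-A P′ (φ⁺ i) G′ (R′ (φ⁺ g)) G′-cf (proj₁ (rep′ (φ⁺ g)))
                 (trans G′∈ (sym (proj₂ (rep′ (φ⁺ g))))))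
          (trans (A≡ i g) (sym (blk-A P i G (R g) G-cf (proj₁ (rep g)) (sym (proj₂ (rep g))))))
    where
    g : Fin k
    g = blk P G

  Transfers : Fin k → Subset n → Subset n′ → Set
  Transfers i G G′ = ∀ s → σ i G s ≡ ′.σ (φ⁺ i) G′ s × ι i G s ≡ ′.ι (φ⁺ i) G′ s

  TransfersAt : ℕ → Set
  TransfersAt μ = ∀ i G G′ → ∣ G ∣ ∸ ∣ R i ∣ ≡ μ → Corresponding G G′ → Transfers i G G′

  module Step (μ : ℕ) (ih : ∀ {μ′} → μ′ < μ → TransfersAt μ′)
              (i : Fin k) (G : Subset n) (G′ : Subset n′) (μ≡ : ∣ G ∣ ∸ ∣ R i ∣ ≡ μ)
              (corr : Corresponding G G′) where

    G-cf : IsCyclicFlat M G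
    G-cf = proj₁ corr

    G′-cf : IsCyclicFlat M′ G′
    G′-cf = proj₁ (proj₂ corr)

    G′∈ : blk P′ G′ ≡ φ⁺ (blk P G)
    G′∈ = proj₂ (proj₂ corr)

    transfers-below : ∀ i′ H H′ → ∣ H ∣ ∸ ∣ R i′ ∣ < μ → Corresponding H H′ → Transfers i′ H H′
    transfers-below i′ H H′ lt = ih lt i′ H H′ refl

    term-transfer-between : ∀ j s → ∣ R i ∣ < ∣ R j ∣ → ∣ R j ∣ < ∣ G ∣ →
                            term i G j s ≡ ′.term (φ⁺ i) G′ (φ⁺ j) s
    term-transfer-between j s Ri<Rj Rj<G =
      begin
        term i G j s
      ≡⟨ term-factor i G j s c σ≡c ⟩
        (c ⋆ ι j G) s
      ≡⟨ ∑≤-cong s (λ t _ → cong (c t *_) (proj₂ (transfers-below j G G′ G-closer corr (s ∸ t)))) ⟩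
        (c ⋆ ′.ι (φ⁺ j) G′) s
      ≡⟨ ′.term-factor (φ⁺ i) G′ (φ⁺ j) s c σ′≡c ⟨
        ′.term (φ⁺ i) G′ (φ⁺ j) s
      ∎
      where
      open ≡-Reasoning
      Rj-closer : ∣ R j ∣ ∸ ∣ R i ∣ < μ
      Rj-closer = subst (∣ R j ∣ ∸ ∣ R i ∣ <_) μ≡ (∸-monoˡ-< Rj<G (<⇒≤ Ri<Rj))
      G-closer : ∣ G ∣ ∸ ∣ R j ∣ < μ
      G-closer = subst (∣ G ∣ ∸ ∣ R j ∣ <_) μ≡ (∸-monoʳ-< Ri<Rj (<⇒≤ Rj<G))
      c : ℕ → ℕ
      c = ′.σ (φ⁺ i) (R′ (φ⁺ j))
      σ≡c : ∀ H → InBlockBelow j G H → ∀ t → σ i H t ≡ c t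
      σ≡c H (H-cf , H∈j , _) t = proj₁ (transfers-below i H (R′ (φ⁺ j))
        (subst (λ m → m ∸ ∣ R i ∣ < μ) (sym (∣∣-block H-cf H∈j)) Rj-closer)
        (H-cf , proj₁ (rep′ (φ⁺ j)) , trans (proj₂ (rep′ (φ⁺ j))) (cong φ⁺ (sym H∈j))) t)
      σ′≡c : ∀ H′ → ′.InBlockBelow (φ⁺ j) G′ H′ → ∀ t → ′.σ (φ⁺ i) H′ t ≡ c t
      σ′≡c H′ (H′-cf , H′∈ , _) t =
        trans (sym (proj₁ (transfers-below i (R j) H′ Rj-closer
                            (proj₁ (rep j) , H′-cf , trans H′∈ (cong φ⁺ (sym (proj₂ (rep j))))) t)))
              (proj₁ (transfers-below i (R j) (R′ (φ⁺ j)) Rj-closer (rep-corresponding j) t))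

    term-transfer : ∀ j s → j ≢ i → j ≢ blk P G → term i G j s ≡ ′.term (φ⁺ i) G′ (φ⁺ j) s
    term-transfer j s j≢i j≢G with ∣ R j ∣ ≤? ∣ R i ∣ | ∣ G ∣ ≤? ∣ R j ∣
    ... | yes Rj≤Ri | _ =
      trans (term-small i G j s j≢i Rj≤Ri)
            (sym (′.term-small (φ⁺ i) G′ (φ⁺ j) s (j≢i ∘ φ⁺-injective)
                               (subst₂ _≤_ (sym (∣R∣≡ j)) (sym (∣R∣≡ i)) Rj≤Ri)))
    ... | no _ | yes G≤Rj =
      trans (term-large i G j s G-cf j≢G G≤Rj)
            (sym (′.term-large (φ⁺ i) G′ (φ⁺ j) s G′-cf (λ e → j≢G (φ⁺-injective (trans e G′∈)))
                               (subst₂ _≤_ (sym (corresponding-∣∣ corr)) (sym (∣R∣≡ j)) G≤Rj)))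
    ... | no Ri<Rj | no Rj<G = term-transfer-between j s (≰⇒> Ri<Rj) (≰⇒> Rj<G)

    rest-transfer : ∀ s → rest i G s ≡ ′.rest (φ⁺ i) G′ s
    rest-transfer s = begin
      rest i G s
        ≡⟨ sum-cong-≗ (λ j → 𝟙*-cong (Distinct₂? (blk P G) i j) λ (j≢G , j≢i) →
                                term-transfer j s j≢i j≢G) ⟩
      sum (λ j → 𝟙 (Distinct₂? (blk P G) i j) * ′.term (φ⁺ i) G′ (φ⁺ j) s)
        ≡⟨ sum-cong-≗ (λ j → cong (_* ′.term (φ⁺ i) G′ (φ⁺ j) s) (𝟙-distinct j)) ⟩
      sum (λ j → 𝟙 (Distinct₂? (blk P′ G′) (φ⁺ i) (φ⁺ j)) * ′.term (φ⁺ i) G′ (φ⁺ j) s)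
        ≡⟨ sum-bijection φ (λ j′ → 𝟙 (Distinct₂? (blk P′ G′) (φ⁺ i) j′) *
                                   ′.term (φ⁺ i) G′ j′ s) ⟨
      ′.rest (φ⁺ i) G′ s ∎
      where
      open ≡-Reasoning
      𝟙-distinct : ∀ j → 𝟙 (Distinct₂? (blk P G) i j) ≡ 𝟙 (Distinct₂? (blk P′ G′) (φ⁺ i) (φ⁺ j))
      𝟙-distinct j = 𝟙-cong (Distinct₂? (blk P G) i j) (Distinct₂? (blk P′ G′) (φ⁺ i) (φ⁺ j))
        (λ (j≢G , j≢i) → (λ e → j≢G (φ⁺-injective (trans e G′∈))) , j≢i ∘ φ⁺-injective)
        (λ (j≢G , j≢i) → (λ e → j≢G (trans (cong φ⁺ e) (sym G′∈))) , j≢i ∘ cong φ⁺)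

    transfers-off-block : i ≢ blk P G → Transfers i G G′
    transfers-off-block i≢G s = +-cancel-vanishing split-eq vanishing
      where
      φi≢G′ : φ⁺ i ≢ blk P′ G′
      φi≢G′ e = i≢G (φ⁺-injective (trans e G′∈))
      split-eq : σ i G s + (ι i G s + rest i G s) ≡ ′.σ (φ⁺ i) G′ s + (′.ι (φ⁺ i) G′ s + rest i G s)
      split-eq = begin
        σ i G s + (ι i G s + rest i G s)
          ≡⟨ Acount-choose-split i G s G-cf i≢G ⟨
        Acount M (blk P) i G * ((∣ G ∣ ∸ ∣ R i ∣) choose s)
          ≡⟨ cong₂ (λ a m → a * ((m ∸ ∣ R i ∣) choose s))
                   (corresponding-Acount i corr) (corresponding-∣∣ corr) ⟨
        Acount M′ (blk P′) (φ⁺ i) G′ * ((∣ G′ ∣ ∸ ∣ R i ∣) choose s)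
          ≡⟨ cong (λ m → Acount M′ (blk P′) (φ⁺ i) G′ * ((∣ G′ ∣ ∸ m) choose s)) (∣R∣≡ i) ⟨
        Acount M′ (blk P′) (φ⁺ i) G′ * ((∣ G′ ∣ ∸ ∣ R′ (φ⁺ i) ∣) choose s)
          ≡⟨ ′.Acount-choose-split (φ⁺ i) G′ s G′-cf φi≢G′ ⟩
        ′.σ (φ⁺ i) G′ s + (′.ι (φ⁺ i) G′ s + ′.rest (φ⁺ i) G′ s)
          ≡⟨ cong (λ x → ′.σ (φ⁺ i) G′ s + (′.ι (φ⁺ i) G′ s + x)) (rest-transfer s) ⟨
        ′.σ (φ⁺ i) G′ s + (′.ι (φ⁺ i) G′ s + rest i G s) ∎
        where open ≡-Reasoning
      gap′≡gap : rank M′ G′ ∸ rank M′ (R′ (φ⁺ i)) ≡ rank M G ∸ rank M (R i)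
      gap′≡gap = cong₂ _∸_ (corresponding-r corr) (rR≡ i)
      -- One of σ and ι vanishes at s, so the single equation split-eq determines both.
      vanishing : (σ i G s ≡ 0 × ′.σ (φ⁺ i) G′ s ≡ 0) ⊎ (ι i G s ≡ 0 × ′.ι (φ⁺ i) G′ s ≡ 0)
      vanishing with s <? rank M G ∸ rank M (R i)
      ... | yes s<gap = inj₁ (σ-below i G s s<gap , ′.σ-below (φ⁺ i) G′ s (subst (s <_) (sym gap′≡gap) s<gap))
      ... | no s≮gap  = inj₂ (ι-beyond i G s G-cf i≢G (≮⇒≥ s≮gap) ,
                              ′.ι-beyond (φ⁺ i) G′ s G′-cf φi≢G′
                                         (subst (_≤ s) (sym gap′≡gap) (≮⇒≥ s≮gap)))

    transfers : Transfers i G G′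
    transfers with i Fin.≟ blk P G
    ... | no i≢G  = transfers-off-block i≢G
    ... | yes i≡G = λ s →
      trans (σ-self i G s G-cf (sym i≡G)) (sym (′.σ-self (φ⁺ i) G′ s G′-cf G′∈φi)) ,
      trans (ι-self i G s G-cf (sym i≡G)) (sym (′.ι-self (φ⁺ i) G′ s G′-cf G′∈φi))
      where
      G′∈φi : blk P′ G′ ≡ φ⁺ i
      G′∈φi = trans G′∈ (cong φ⁺ (sym i≡G))

  transfer : ∀ i G G′ → Corresponding G G′ → Transfers i G G′
  transfer i G G′ = <-rec TransfersAt Step.transfers (∣ G ∣ ∸ ∣ R i ∣) i G G′ refl

module BlockInvariance {n k} (M : Matroid n) (P : Condensation M k)
                       (R : Fin k → Subset n) (rep : IsRepSystem P R) where

  open BlockSums M P R rep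
  open Transfer M M P R rep P R rep (⤖-id (Fin k)) (λ _ _ → refl) (λ _ → refl) (λ _ → refl)

  σ-block-invariant : ∀ i {H j} → IsCyclicFlat M H → blk P H ≡ j → ∀ s → σ i H s ≡ σ i (R j) s
  σ-block-invariant i {H} {j} H-cf H∈j s =
    proj₁ (transfer i H (R j) (H-cf , proj₁ (rep j) , trans (proj₂ (rep j)) (sym H∈j)) s)

module RankGenerating {n k} (M : Matroid n) (P : Condensation M k)
                      (R : Fin k → Subset n) (rep : IsRepSystem P R)
                      (loopless : Loopless M) (coloopless : Coloopless M) where

  open Flats M
  open Decomposition M
  open BlockSums M P R rep
  open BlockInvariance M P R rep

  ⊥-cyclicFlat : IsCyclicFlat M ⊥
  ⊥-cyclicFlat = (λ e _ → subst (_< r (⊥ ∪ ⁅ e ⁆)) (sym r⊥≡0)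
                                (n≢0⇒n>0 λ r≡0 → loopless e (trans (cong r (sym (∪-identityˡ ⁅ e ⁆))) r≡0))) ,
                 (λ _ e∈⊥ → ⊥-elim (∉⊥ e∈⊥))

  ⊤-cyclicFlat : IsCyclicFlat M ⊤
  ⊤-cyclicFlat = (λ _ e∉⊤ → ⊥-elim (e∉⊤ ∈⊤)) , (λ e _ → coloopless e)

  i₀ : Fin k
  i₀ = blk P ⊥

  σ-i₀ : ∀ H s → σ i₀ H s ≡ spanning ⊥ H s
  σ-i₀ H s = ∑⊆-δ ⊤ (inBlockBelow? i₀ H) (λ F → spanning F H s) ⊥ (⊆-max ⊥)
                   (⊥-cyclicFlat , refl , ⊆-min H)
                   λ F _ (F-cf , F∈i₀ , _) → sym (block-⊆-≡ ⊥-cyclicFlat refl F-cf F∈i₀ (⊆-min F))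

  nullityWeight : ℕ → Subset n → ℕ → ℕ
  nullityWeight b X s = 𝟙 (s ∸ r X ≟ b)

  corankWeight : ℕ → Subset n → ℕ → ℕ
  corankWeight a X t = 𝟙 (r ⊤ ∸ r X ∸ t ≟ a)

  rankGen? : ∀ a b X → Dec ((r ⊤ ∸ r X ≡ a) × (∣ X ∣ ∸ r X ≡ b))
  rankGen? a b X = (r ⊤ ∸ r X ≟ a) ×-dec (∣ X ∣ ∸ r X ≟ b)

  module _ (a b : ℕ) where

    𝟙-rankGen-∪ : ∀ {H Y J} → Y ⊆ H → Spans ⊥ H Y → FreeOver H J → Y ∩ J ≡ ⊥ →
                  𝟙 (rankGen? a b (Y ∪ J)) ≡ nullityWeight b H ∣ Y ∣ * corankWeight a H ∣ J ∣
    𝟙-rankGen-∪ {H} {Y} {J} Y⊆H spans (_ , rH∪J) Y∩J≡⊥ =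
      trans (𝟙-× (r ⊤ ∸ r (Y ∪ J) ≟ a) (∣ Y ∪ J ∣ ∸ r (Y ∪ J) ≟ b))
            (trans (*-comm (𝟙 (r ⊤ ∸ r (Y ∪ J) ≟ a)) _)
                   (cong₂ (λ u v → 𝟙 (u ≟ b) * 𝟙 (v ≟ a)) nullity corank))
      where
      rY∪J : r (Y ∪ J) ≡ r H + ∣ J ∣
      rY∪J = trans (r-∪-cong J Y⊆H (trans (cong r (sym (∪-identityˡ Y))) spans)) rH∪J
      nullity : ∣ Y ∪ J ∣ ∸ r (Y ∪ J) ≡ ∣ Y ∣ ∸ r H
      nullity = begin
        ∣ Y ∪ J ∣ ∸ r (Y ∪ J)           ≡⟨ cong₂ _∸_ (∣p∪q∣-disjoint Y J Y∩J≡⊥) rY∪J ⟩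
        (∣ Y ∣ + ∣ J ∣) ∸ (r H + ∣ J ∣) ≡⟨ cong₂ _∸_ (+-comm ∣ Y ∣ ∣ J ∣) (+-comm (r H) ∣ J ∣) ⟩
        (∣ J ∣ + ∣ Y ∣) ∸ (∣ J ∣ + r H) ≡⟨ [m+n]∸[m+o]≡n∸o ∣ J ∣ ∣ Y ∣ (r H) ⟩
        ∣ Y ∣ ∸ r H                     ∎
        where open ≡-Reasoning
      corank : r ⊤ ∸ r (Y ∪ J) ≡ r ⊤ ∸ r H ∸ ∣ J ∣
      corank = trans (cong (r ⊤ ∸_) rY∪J) (sym (∸-+-assoc (r ⊤) (r H) ∣ J ∣))

    spanWeight freeWeight : ℕ → Subset n → ℕ
    spanWeight N H = ∑[ s ≤ N ] spanning ⊥ H s * nullityWeight b H s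
    freeWeight N H = ∑[ t ≤ N ] free H ⊤ t * corankWeight a H t

    ∑-core-factor : ∀ N → n ≤ N → ∀ H →
      coreSum ⊥ ⊤ H (𝟙 ∘ rankGen? a b) ≡ spanWeight N H * freeWeight N H
    ∑-core-factor N n≤N H =
      begin
        coreSum ⊥ ⊤ H (𝟙 ∘ rankGen? a b)
      ≡⟨ ∑⊆-cong (H ─ ⊥) (λ Y Y⊆ → 𝟙*-cong (spans? ⊥ H Y) λ spans → ∑⊆-cong (⊤ ─ H) λ J J⊆ →
           𝟙*-cong (freeOver? H J) λ free → 𝟙-rankGen-∪ (p─q⊆p H ⊥ ∘ Y⊆) spans free (Y∩J≡⊥ Y⊆ J⊆)) ⟩
        ∑[ Y ⊆ H ─ ⊥ ] 𝟙 (spans? ⊥ H Y) * (∑[ J ⊆ ⊤ ─ H ] 𝟙 (freeOver? H J) * (ν Y * κ J))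
      ≡⟨ ∑⊆-cong (H ─ ⊥) (λ Y _ → pull-out Y) ⟩
        ∑[ Y ⊆ H ─ ⊥ ] 𝟙 (spans? ⊥ H Y) * ν Y * ∑⊆ (⊤ ─ H) v
      ≡⟨ *-distribʳ-∑⊆ (H ─ ⊥) (∑⊆ (⊤ ─ H) v) (λ Y → 𝟙 (spans? ⊥ H Y) * ν Y) ⟨
        (∑[ Y ⊆ H ─ ⊥ ] 𝟙 (spans? ⊥ H Y) * ν Y) * ∑⊆ (⊤ ─ H) v
      ≡⟨ cong₂ _*_ (∑⊆-by-size N n≤N (H ─ ⊥) (𝟙 ∘ spans? ⊥ H) (nullityWeight b H))
                   (∑⊆-by-size N n≤N (⊤ ─ H) (𝟙 ∘ freeOver? H) (corankWeight a H)) ⟩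
        spanWeight N H * freeWeight N H
      ∎
      where
      open ≡-Reasoning
      ν κ v : Subset n → ℕ
      ν Y = nullityWeight b H ∣ Y ∣
      κ J = corankWeight a H ∣ J ∣
      v J = 𝟙 (freeOver? H J) * κ J
      Y∩J≡⊥ : ∀ {Y J} → Y ⊆ H ─ ⊥ → J ⊆ ⊤ ─ H → Y ∩ J ≡ ⊥
      Y∩J≡⊥ {Y} {J} Y⊆ J⊆ =
        disjoint Y J λ x∈Y x∈J → x∈p─q⇒x∉q ⊤ H (J⊆ x∈J) (p─q⊆p H ⊥ (Y⊆ x∈Y))
      pull-out : ∀ Y → 𝟙 (spans? ⊥ H Y) * (∑[ J ⊆ ⊤ ─ H ] 𝟙 (freeOver? H J) * (ν Y * κ J)) ≡
                       𝟙 (spans? ⊥ H Y) * ν Y * ∑⊆ (⊤ ─ H) v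
      pull-out Y = trans (cong (𝟙 (spans? ⊥ H Y) *_)
                               (trans (∑⊆-cong (⊤ ─ H) λ J _ → x*yz≡y*xz (𝟙 (freeOver? H J)) (ν Y) (κ J))
                                      (sym (*-distribˡ-∑⊆ (⊤ ─ H) (ν Y) v))))
                         (sym (*-assoc (𝟙 (spans? ⊥ H Y)) (ν Y) (∑⊆ (⊤ ─ H) v)))

    α : ℕ → Fin k → ℕ
    α N j = ∑[ s ≤ N ] σ i₀ (R j) s * nullityWeight b (R j) s

    β : ℕ → Fin k → ℕ
    β N j = ∑[ t ≤ N ] ι j ⊤ t * corankWeight a (R j) t

    block-contribution : ∀ N j →
      ∑[ H ⊆ ⊤ ] 𝟙 (inBlockBelow? j ⊤ H) * (spanWeight N H * freeWeight N H) ≡ α N j * β N j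
    block-contribution N j =
      begin
        ∑[ H ⊆ ⊤ ] 𝟙 (inBlockBelow? j ⊤ H) * (spanWeight N H * freeWeight N H)
      ≡⟨ ∑⊆-cong ⊤ (λ H _ → 𝟙*-cong (inBlockBelow? j ⊤ H) λ (H-cf , H∈j , _) →
           cong₂ _*_ (∑≤-cong N λ s _ → cong₂ _*_ (trans (sym (σ-i₀ H s)) (σ-block-invariant i₀ H-cf H∈j s))
                                                  (cong (λ m → 𝟙 (s ∸ m ≟ b)) (r-block H-cf H∈j)))
                     (∑≤-cong N λ t _ → cong (λ m → free H ⊤ t * 𝟙 (r ⊤ ∸ m ∸ t ≟ a))
                                             (r-block H-cf H∈j))) ⟩
        ∑[ H ⊆ ⊤ ] 𝟙 (inBlockBelow? j ⊤ H) * (α N j * B H)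
      ≡⟨ ∑⊆-cong ⊤ (λ H _ → x*yz≡y*xz (𝟙 (inBlockBelow? j ⊤ H)) (α N j) (B H)) ⟩
        ∑[ H ⊆ ⊤ ] α N j * (𝟙 (inBlockBelow? j ⊤ H) * B H)
      ≡⟨ *-distribˡ-∑⊆ ⊤ (α N j) (λ H → 𝟙 (inBlockBelow? j ⊤ H) * B H) ⟨
        α N j * (∑[ H ⊆ ⊤ ] 𝟙 (inBlockBelow? j ⊤ H) * B H)
      ≡⟨ cong (α N j *_) (trans (∑⊆-cong ⊤ λ H _ → *-distribˡ-∑≤ N (𝟙 (inBlockBelow? j ⊤ H))
                                                                    λ t → free H ⊤ t * w t)
                                (∑⊆-∑≤-comm ⊤ N λ H t → 𝟙 (inBlockBelow? j ⊤ H) * (free H ⊤ t * w t))) ⟩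
        α N j * (∑[ t ≤ N ] ∑[ H ⊆ ⊤ ] 𝟙 (inBlockBelow? j ⊤ H) * (free H ⊤ t * w t))
      ≡⟨ cong (α N j *_) (∑≤-cong N λ t _ →
           trans (∑⊆-cong ⊤ λ H _ → sym (*-assoc (𝟙 (inBlockBelow? j ⊤ H)) (free H ⊤ t) (w t)))
                 (sym (*-distribʳ-∑⊆ ⊤ (w t) λ H → 𝟙 (inBlockBelow? j ⊤ H) * free H ⊤ t))) ⟩
        α N j * β N j
      ∎
      where
      open ≡-Reasoning
      w : ℕ → ℕ
      w = corankWeight a (R j)
      B : Subset n → ℕ
      B H = ∑[ t ≤ N ] free H ⊤ t * w t

    rankGenCoeff-blocks : ∀ N → n ≤ N → rankGenCoeff M a b ≡ sum (λ j → α N j * β N j)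
    rankGenCoeff-blocks N n≤N =
      begin
        rankGenCoeff M a b
      ≡⟨ count≡∑⊆ (rankGen? a b) ⟩
        ∑[ X ⊆ ⊤ ] g X
      ≡⟨ cong (λ U → ∑⊆ U g) (p─⊥≡p ⊤) ⟨
        ∑[ X ⊆ ⊤ ─ ⊥ ] g X
      ≡⟨ ∑-by-core ⊥ ⊤ (proj₂ ⊥-cyclicFlat) (proj₁ ⊤-cyclicFlat) (⊆-min ⊤) g ⟩
        ∑[ H ⊆ ⊤ ] 𝟙 (between? ⊥ ⊤ H) * coreSum ⊥ ⊤ H g
      ≡⟨ ∑⊆-cong ⊤ (λ H _ → cong₂ _*_ (𝟙-between H) (∑-core-factor N n≤N H)) ⟩
        ∑[ H ⊆ ⊤ ] 𝟙 (cyclicFlatBelow? ⊤ H) * (spanWeight N H * freeWeight N H)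
      ≡⟨ ∑-blocks ⊤ (λ H → spanWeight N H * freeWeight N H) ⟩
        sum (λ j → ∑[ H ⊆ ⊤ ] 𝟙 (inBlockBelow? j ⊤ H) * (spanWeight N H * freeWeight N H))
      ≡⟨ sum-cong-≗ (block-contribution N) ⟩
        sum (λ j → α N j * β N j)
      ∎
      where
      open ≡-Reasoning
      g : Subset n → ℕ
      g = 𝟙 ∘ rankGen? a b
      𝟙-between : ∀ H → 𝟙 (between? ⊥ ⊤ H) ≡ 𝟙 (cyclicFlatBelow? ⊤ H)
      𝟙-between H = 𝟙-cong (between? ⊥ ⊤ H) (cyclicFlatBelow? ⊤ H)
                           (λ (H-cf , _ , H⊆⊤) → H-cf , H⊆⊤) (λ (H-cf , H⊆⊤) → H-cf , ⊆-min H , H⊆⊤)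

module Comparison {n n′ k k′} (M : Matroid n) (M′ : Matroid n′)
  (loopless : Loopless M) (coloopless : Coloopless M)
  (loopless′ : Loopless M′) (coloopless′ : Coloopless M′)
  (P : Condensation M k) (R : Fin k → Subset n) (rep : IsRepSystem P R)
  (P′ : Condensation M′ k′) (R′ : Fin k′ → Subset n′) (rep′ : IsRepSystem P′ R′)
  (φ : Fin k ⤖ Fin k′)
  (A≡ : ∀ i j → A P′ R′ (Bijection.to φ i) (Bijection.to φ j) ≡ A P R i j)
  (∣R∣≡ : ∀ i → ∣ R′ (Bijection.to φ i) ∣ ≡ ∣ R i ∣)
  (rR≡ : ∀ i → rank M′ (R′ (Bijection.to φ i)) ≡ rank M (R i)) where

  open Transfer M M′ P R rep P′ R′ rep′ φ A≡ ∣R∣≡ rR≡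
  open BlockSums M P R rep
  module G = RankGenerating M P R rep loopless coloopless
  module G′ = RankGenerating M′ P′ R′ rep′ loopless′ coloopless′

  ∅-block : G′.i₀ ≡ φ⁺ G.i₀
  ∅-block =
    trans (cong (blk P′) (⊆-∣∣-≡ (⊆-min (R′ (φ⁺ G.i₀))) R′i₀-size)) (proj₂ (rep′ (φ⁺ G.i₀)))
    where
    R′i₀-size : ∣ R′ (φ⁺ G.i₀) ∣ ≤ ∣ ⊥ {n′} ∣
    R′i₀-size = ≤-reflexive (trans (∣R∣≡ G.i₀) (trans (sym (∣∣-block G.⊥-cyclicFlat refl))
                                                       (trans (∣⊥∣≡0 n) (sym (∣⊥∣≡0 n′)))))

  n≤n′ : n ≤ n′
  n≤n′ = begin
    n                       ≡⟨ ∣⊤∣≡n n ⟨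
    ∣ ⊤ {n} ∣               ≡⟨ ∣∣-block G.⊤-cyclicFlat refl ⟩
    ∣ R (blk P ⊤) ∣         ≡⟨ ∣R∣≡ (blk P ⊤) ⟨
    ∣ R′ (φ⁺ (blk P ⊤)) ∣   ≤⟨ ∣p∣≤n (R′ (φ⁺ (blk P ⊤))) ⟩
    n′                      ∎
    where open ≤-Reasoning

  n′≤n : n′ ≤ n
  n′≤n with j , φj≡ ← Bijection.strictlySurjective φ (blk P′ ⊤) = begin
    n′                      ≡⟨ ∣⊤∣≡n n′ ⟨
    ∣ ⊤ {n′} ∣              ≡⟨ ′.∣∣-block G′.⊤-cyclicFlat (sym φj≡) ⟩
    ∣ R′ (φ⁺ j) ∣           ≡⟨ ∣R∣≡ j ⟩
    ∣ R j ∣                 ≤⟨ ∣p∣≤n (R j) ⟩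
    n                       ∎
    where open ≤-Reasoning

  E-corresponding : Corresponding ⊤ ⊤
  E-corresponding = G.⊤-cyclicFlat , G′.⊤-cyclicFlat ,
    trans (cong (blk P′) (sym (∣p∣≡n⇒p≡⊤ R′-size))) (proj₂ (rep′ (φ⁺ (blk P ⊤))))
    where
    R′-size : ∣ R′ (φ⁺ (blk P ⊤)) ∣ ≡ n′
    R′-size = trans (∣R∣≡ (blk P ⊤)) (trans (sym (∣∣-block G.⊤-cyclicFlat refl))
                                            (trans (∣⊤∣≡n n) (≤-antisym n≤n′ n′≤n)))

  module _ (a b N : ℕ) where

    α-transfer : ∀ j → G.α a b N j ≡ G′.α a b N (φ⁺ j)
    α-transfer j = ∑≤-cong N λ s _ →
      cong₂ _*_ (trans (proj₁ (transfer G.i₀ (R j) (R′ (φ⁺ j)) (rep-corresponding j) s))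
                       (cong (λ i → ′.σ i (R′ (φ⁺ j)) s) (sym ∅-block)))
                (cong (λ m → 𝟙 (s ∸ m ≟ b)) (sym (rR≡ j)))

    β-transfer : ∀ j → G.β a b N j ≡ G′.β a b N (φ⁺ j)
    β-transfer j = ∑≤-cong N λ t _ →
      cong₂ _*_ (proj₂ (transfer j ⊤ ⊤ E-corresponding t))
                (cong₂ (λ u v → 𝟙 (u ∸ v ∸ t ≟ a)) (sym (corresponding-r E-corresponding)) (sym (rR≡ j)))

theorem5p4 :
    ∀ {n n' k k' : ℕ} (M : Matroid n) (M' : Matroid n') →
    Loopless M → Coloopless M → Loopless M' → Coloopless M' →
    (P : Condensation M k) (R : Fin k → Subset n) → IsRepSystem P R →
    (P' : Condensation M' k') (R' : Fin k' → Subset n') → IsRepSystem P' R' →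
    (φ : Fin k ⤖ Fin k') →
    (∀ (i j : Fin k) →
      A P' R' (Bijection.to φ i) (Bijection.to φ j) ≡ A P R i j) →
    (∀ (i : Fin k) → ∣ R' (Bijection.to φ i) ∣ ≡ ∣ R i ∣) →
    (∀ (i : Fin k) → rank M' (R' (Bijection.to φ i)) ≡ rank M (R i)) →
    ∀ (a b : ℕ) → rankGenCoeff M a b ≡ rankGenCoeff M' a b
theorem5p4 {n} {n'} M M' ll cl ll' cl' P R rep P' R' rep' φ A≡ ∣R∣≡ rR≡ a b =
  begin
    rankGenCoeff M a b
  ≡⟨ G.rankGenCoeff-blocks a b N (m≤m+n n n') ⟩
    sum (λ j → G.α a b N j * G.β a b N j)
  ≡⟨ sum-cong-≗ (λ j → cong₂ _*_ (α-transfer a b N j) (β-transfer a b N j)) ⟩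
    sum (λ j → G′.α a b N (Bijection.to φ j) * G′.β a b N (Bijection.to φ j))
  ≡⟨ sum-bijection φ (λ j′ → G′.α a b N j′ * G′.β a b N j′) ⟨
    sum (λ j′ → G′.α a b N j′ * G′.β a b N j′)
  ≡⟨ G′.rankGenCoeff-blocks a b N (m≤n+m n' n) ⟨
    rankGenCoeff M' a b
  ∎
  where
  open ≡-Reasoning
  open Comparison M M' ll cl ll' cl' P R rep P' R' rep' φ A≡ ∣R∣≡ rR≡
  N : ℕ
  N = n + n'
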